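{- For integers $k\ge2$ and $1\le r\le n$, $$t(n,k,r)=\sum_{a\ge r}(-1)^{a-r}e_{a-r}(1,2,\dots,a-1)\sum_{\substack{\lambda\vdash n\\ l(\lambda)=a}}f_\lambda\prod_{j=1}^{l(\lambda)}t(\lambda_j,k-1,1).$$
   Context: $s(a,b)$ are the signed Stirling numbers of the first kind, $x(x-1)\cdots(x-a+1)=\sum_b s(a,b)x^b$, and $t(n,k,r)=\sum\prod_{j=1}^{k}s(i_{j-1},i_j)$ over integer tuples $n\ge i_1\ge\dots\ge i_{k-1}\ge r$ with $i_0=n$, $i_k=r$. $e_m(x_1,\dots,x_N)=\sum_{1\le j_1<\dots<j_m\le N}x_{j_1}\cdots x_{j_m}$ is the elementary symmetric function ($e_0=1$), here evaluated at $x_i=i$. For a partition $\lambda\vdash n$ of length $l(\lambda)$ with $m_j$ parts equal to $j$, $f_\lambda=\frac{n!}{\prod_j (j!)^{m_j}m_j!}$. -}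

module Defs where

open import Data.Nat as ℕ using (ℕ; zero; suc; _∸_; _!; NonZero)
open import Data.Nat.Properties using (m*n≢0; m^n≢0; _!≢0)
open import Data.Integer as ℤ using (ℤ; +_)
open import Data.List using (List; []; _∷_; map; concatMap; upTo; length; filter; foldr)
open import Relation.Binary.PropositionalEquality using (_≡_)
open import Relation.Nullary using (yes; no)

-- Polynomials over ℤ as coefficient lists (index b = coefficient of x^b)

Poly : Set
Poly = List ℤ

_⊕_ : Poly → Poly → Poly
[]       ⊕ q        = q
p        ⊕ []       = p
(a ∷ p)  ⊕ (b ∷ q)  = (a ℤ.+ b) ∷ (p ⊕ q)

scale : ℤ → Poly → Poly
scale c = map (c ℤ.*_)

mulXminus : Poly → ℤ → Poly
mulXminus p c = (+ 0 ∷ p) ⊕ scale (ℤ.- c) p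

coeff : Poly → ℕ → ℤ
coeff []       _       = + 0
coeff (a ∷ p)  zero    = a
coeff (a ∷ p)  (suc b) = coeff p b

fallingFactorial : ℕ → Poly
fallingFactorial zero    = + 1 ∷ []
fallingFactorial (suc a) = mulXminus (fallingFactorial a) (+ a)

s : ℕ → ℕ → ℤ
s a b = coeff (fallingFactorial a) b

sumℤ : List ℤ → ℤ
sumℤ = foldr ℤ._+_ (+ 0)

prodℤ : List ℤ → ℤ
prodℤ = foldr ℤ._*_ (+ 1)

-- the list [lo, lo+1, ..., hi] (empty if hi < lo)
range : ℕ → ℕ → List ℕ
range lo hi = map (lo ℕ.+_) (upTo (suc hi ∸ lo))

-- t(n,k,r) = Σ over n = i_0 ≥ i_1 ≥ ... ≥ i_{k-1} ≥ i_k = r of Π_{j=1}^k s(i_{j-1}, i_j).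
-- Written as the nested sum over i_1, then the remaining chain:
-- chains of length 0 from n to r: just the empty product if n = r.

t : ℕ → ℕ → ℕ → ℤ
t n zero    r with n ℕ.≟ r
... | yes _ = + 1
... | no  _ = + 0
t n (suc zero) r = s n r
t n (suc (suc k)) r = sumℤ (map (λ i → s n i ℤ.* t i (suc k) r) (range r n))

e : ℕ → List ℤ → ℤ
e zero    _        = + 1
e (suc m) []       = + 0
e (suc m) (x ∷ xs) = e (suc m) xs ℤ.+ x ℤ.* e m xs

oneTo : ℕ → List ℤ
oneTo N = map (λ i → + i) (range 1 N)

-- Partitions of n: nonincreasing lists of positive integers summing to n.
-- partsAux fuel n m = all partitions of n with all parts ≤ m
-- (fuel ≥ n suffices since each part is ≥ 1).

partsAux : ℕ → ℕ → ℕ → List (List ℕ)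
partsAux _          zero     _ = [] ∷ []
partsAux zero       (suc _)  _ = []
partsAux (suc fuel) (suc n)  m =
  concatMap (λ p → map (p ∷_) (partsAux fuel (suc n ∸ p) p)) (range 1 (ℕ._⊓_ m (suc n)))

partitions : ℕ → List (List ℕ)
partitions n = partsAux n n n

partitionsOfLength : ℕ → ℕ → List (List ℕ)
partitionsOfLength n a = filter (λ λ′ → length λ′ ℕ.≟ a) (partitions n)

mult : ℕ → List ℕ → ℕ
mult j λ′ = length (filter (λ x → x ℕ.≟ j) λ′)

prodℕ : List ℕ → ℕ
prodℕ = foldr ℕ._*_ 1

denomFactor : List ℕ → ℕ → ℕ
denomFactor λ′ j = ((j !) ℕ.^ mult j λ′) ℕ.* (mult j λ′ !)

-- Π_{j=1}^{n} (j!)^{m_j} m_j!   (m_j = 0 for j > n when λ ⊢ n)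
denom : ℕ → List ℕ → ℕ
denom n λ′ = prodℕ (map (denomFactor λ′) (range 1 n))

denomFactor-nonZero : ∀ λ′ j → NonZero (denomFactor λ′ j)
denomFactor-nonZero λ′ j =
  m*n≢0 _ _ {{m^n≢0 (j !) (mult j λ′) {{j !≢0}}}} {{mult j λ′ !≢0}}

prodMap-nonZero : (f : ℕ → ℕ) → (∀ j → NonZero (f j)) → ∀ xs → NonZero (prodℕ (map f xs))
prodMap-nonZero f nz []       = _
prodMap-nonZero f nz (x ∷ xs) = m*n≢0 _ _ {{nz x}} {{prodMap-nonZero f nz xs}}

denom-nonZero : ∀ n λ′ → NonZero (denom n λ′)
denom-nonZero n λ′ = prodMap-nonZero (denomFactor λ′) (denomFactor-nonZero λ′) (range 1 n)

f : ℕ → List ℕ → ℕ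
f n λ′ = ((n !) ℕ./ denom n λ′) {{denom-nonZero n λ′}}

-- Right-hand side of the theorem.
-- The sum over a ≥ r is truncated at a = n: there are no partitions of n
-- of length a > n, so those terms are empty sums.

inner : ℕ → ℕ → ℕ → ℤ
inner n k a = sumℤ (map (λ λ′ → (+ f n λ′) ℤ.* prodℤ (map (λ λj → t λj (k ∸ 1) 1) λ′))
                        (partitionsOfLength n a))

rhs : ℕ → ℕ → ℕ → ℤ
rhs n k r = sumℤ (map (λ a → ((ℤ.- + 1) ℤ.^ (a ∸ r)) ℤ.* e (a ∸ r) (oneTo (a ∸ 1)) ℤ.* inner n k a)
                      (range r n))

{-# OPTIONS --safe #-}
module Submission where

-- Write S = (s(a,b)) for the lower triangular Stirling matrix, so that t(·,k,·) = S^k and, S commuting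
-- with its powers, t(n,k,r) = Σ_a t(n,k-1,a) s(a,r). The recurrence s(a+1,r) = s(a,r-1) - a s(a,r) gives
-- s(a,r) = (-1)^(a-r) e_(a-r)(1,…,a-1). It remains to show t(n,k-1,a) = B_(n,a)(x), the partial Bell
-- polynomial in x_j = t(j,k-1,1). Vandermonde's identity (x+y)_n = Σ_j C(n,j) (x)_j (y)_(n-j) says that
-- S satisfies the convolution recurrence (a+1) X(n,a+1) = Σ_j C(n,j) X(j,1) X(n-j,a), and multiplying by
-- S on the left preserves it, so every power of S does. The partial Bell polynomials satisfy the same
-- recurrence, by induction on the largest allowed part m+1, splitting off all parts equal to m+1 at once;
-- and an array satisfying it is determined by its columns a = 0 and a = 1.

open import Defs
open import Data.Nat using (ℕ; _≤_)
open import Data.Integer using (ℤ)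
open import Relation.Binary.PropositionalEquality using (_≡_)

module Sum where

  open import Data.Nat as ℕ using (ℕ; zero; suc; _∸_; _<_; _≤_; z≤n; s≤s)
  import Data.Nat.Properties as ℕ
  open import Data.Integer using (ℤ; +_; _+_; _*_)
  open import Data.Integer.Properties
  open import Data.Integer.Tactic.RingSolver using (solve-∀)
  open import Data.List using ([]; _∷_; _++_; map; upTo; applyUpTo)
  open import Data.List.Relation.Unary.All using (All; []; _∷_)
  open import Data.List.Properties using (map-∘)
  open import Relation.Nullary using (yes; no)
  open import Function using (_∘_)
  open import Relation.Binary.PropositionalEquality
  open ≡-Reasoning
  open import Data.Nat.Combinatorics using (_C_; k>n⇒nCk≡0; nCk+nC[k+1]≡[n+1]C[k+1])

  ∑ : ℕ → (ℕ → ℤ) → ℤ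
  ∑ zero    f = + 0
  ∑ (suc n) f = f 0 + ∑ n (f ∘ suc)

  syntax ∑ n (λ i → e) = ∑[ i < n ] e

  ∑-cong-< : ∀ n {f g : ℕ → ℤ} → (∀ i → i < n → f i ≡ g i) → ∑ n f ≡ ∑ n g
  ∑-cong-< zero    eq = refl
  ∑-cong-< (suc n) eq = cong₂ _+_ (eq 0 (s≤s z≤n)) (∑-cong-< n (λ i i<n → eq (suc i) (s≤s i<n)))

  ∑-cong : ∀ n {f g : ℕ → ℤ} → (∀ i → f i ≡ g i) → ∑ n f ≡ ∑ n g
  ∑-cong n eq = ∑-cong-< n (λ i _ → eq i)

  ∑-zero : ∀ n {f : ℕ → ℤ} → (∀ i → i < n → f i ≡ + 0) → ∑ n f ≡ + 0
  ∑-zero zero    eq = refl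
  ∑-zero (suc n) eq = cong₂ _+_ (eq 0 (s≤s z≤n)) (∑-zero n (λ i i<n → eq (suc i) (s≤s i<n)))

  ∑-init-last : ∀ n (f : ℕ → ℤ) → ∑ (suc n) f ≡ ∑ n f + f n
  ∑-init-last zero    f = +-comm (f 0) (+ 0)
  ∑-init-last (suc n) f = begin
    f 0 + ∑ (suc n) (f ∘ suc)          ≡⟨ cong (_+_ (f 0)) (∑-init-last n (f ∘ suc)) ⟩
    f 0 + (∑ n (f ∘ suc) + f (suc n))  ≡⟨ +-assoc (f 0) _ _ ⟨
    f 0 + ∑ n (f ∘ suc) + f (suc n)    ∎

  ∑-head : ∀ n (f : ℕ → ℤ) → f 0 ≡ + 0 → ∑ (suc n) f ≡ ∑ n (f ∘ suc)
  ∑-head n f f0≡0 = trans (cong (_+ ∑ n (f ∘ suc)) f0≡0) (+-identityˡ _)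

  ∑-distrib-+ : ∀ n (f g : ℕ → ℤ) → ∑[ i < n ] (f i + g i) ≡ ∑ n f + ∑ n g
  ∑-distrib-+ zero    f g = refl
  ∑-distrib-+ (suc n) f g = begin
    f 0 + g 0 + ∑[ i < n ] (f (suc i) + g (suc i))  ≡⟨ cong (_+_ (f 0 + g 0)) (∑-distrib-+ n (f ∘ suc) (g ∘ suc)) ⟩
    f 0 + g 0 + (∑ n (f ∘ suc) + ∑ n (g ∘ suc))    ≡⟨ middle-swap (f 0) (g 0) _ _ ⟩
    f 0 + ∑ n (f ∘ suc) + (g 0 + ∑ n (g ∘ suc))    ∎
    where
    middle-swap : ∀ a b c d → a + b + (c + d) ≡ a + c + (b + d)
    middle-swap = solve-∀

  ∑-distribˡ : ∀ n (c : ℤ) (f : ℕ → ℤ) → ∑[ i < n ] (c * f i) ≡ c * ∑ n f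
  ∑-distribˡ zero    c f = sym (*-zeroʳ c)
  ∑-distribˡ (suc n) c f = begin
    c * f 0 + ∑[ i < n ] (c * f (suc i)) ≡⟨ cong (_+_ (c * f 0)) (∑-distribˡ n c (f ∘ suc)) ⟩
    c * f 0 + c * ∑ n (f ∘ suc)          ≡⟨ *-distribˡ-+ c (f 0) _ ⟨
    c * (f 0 + ∑ n (f ∘ suc))            ∎

  ∑-distribʳ : ∀ n (c : ℤ) (f : ℕ → ℤ) → ∑[ i < n ] (f i * c) ≡ ∑ n f * c
  ∑-distribʳ n c f = begin
    ∑[ i < n ] (f i * c) ≡⟨ ∑-cong n (λ i → *-comm (f i) c) ⟩
    ∑[ i < n ] (c * f i) ≡⟨ ∑-distribˡ n c f ⟩
    c * ∑ n f            ≡⟨ *-comm c _ ⟩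
    ∑ n f * c            ∎

  ∑-split : ∀ m n (f : ℕ → ℤ) → ∑ (m ℕ.+ n) f ≡ ∑ m f + ∑[ i < n ] f (m ℕ.+ i)
  ∑-split zero    n f = sym (+-identityˡ _)
  ∑-split (suc m) n f = begin
    f 0 + ∑ (m ℕ.+ n) (f ∘ suc)                         ≡⟨ cong (_+_ (f 0)) (∑-split m n (f ∘ suc)) ⟩
    f 0 + (∑ m (f ∘ suc) + ∑[ i < n ] f (suc (m ℕ.+ i))) ≡⟨ +-assoc (f 0) _ _ ⟨
    f 0 + ∑ m (f ∘ suc) + ∑[ i < n ] f (suc (m ℕ.+ i))   ∎

  ∑-comm : ∀ m n (f : ℕ → ℕ → ℤ) → ∑[ i < m ] ∑[ j < n ] f i j ≡ ∑[ j < n ] ∑[ i < m ] f i j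
  ∑-comm zero    n f = sym (∑-zero n (λ _ _ → refl))
  ∑-comm (suc m) n f = begin
    ∑ n (f 0) + ∑[ i < m ] ∑ n (f (suc i))         ≡⟨ cong (_+_ (∑ n (f 0))) (∑-comm m n (f ∘ suc)) ⟩
    ∑ n (f 0) + ∑[ j < n ] ∑[ i < m ] f (suc i) j ≡⟨ ∑-distrib-+ n (f 0) _ ⟨
    ∑[ j < n ] (f 0 j + ∑[ i < m ] f (suc i) j)   ∎

  ∑-pad : ∀ m n {f : ℕ → ℤ} → m ≤ n → (∀ i → m ≤ i → i < n → f i ≡ + 0) → ∑ m f ≡ ∑ n f
  ∑-pad m n {f} m≤n vanish = begin
    ∑ m f                                 ≡⟨ +-identityʳ _ ⟨
    ∑ m f + + 0                           ≡⟨ cong (_+_ (∑ m f)) (∑-zero (n ∸ m) tail-vanishes) ⟨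
    ∑ m f + ∑[ i < n ∸ m ] f (m ℕ.+ i)    ≡⟨ ∑-split m (n ∸ m) f ⟨
    ∑ (m ℕ.+ (n ∸ m)) f                   ≡⟨ cong (λ k → ∑ k f) (ℕ.m+[n∸m]≡n m≤n) ⟩
    ∑ n f                                 ∎
    where
    tail-vanishes : ∀ i → i < n ∸ m → f (m ℕ.+ i) ≡ + 0
    tail-vanishes i i<n∸m = vanish (m ℕ.+ i) (ℕ.m≤m+n m i)
      (subst (m ℕ.+ i <_) (ℕ.m+[n∸m]≡n m≤n) (ℕ.+-monoʳ-< m i<n∸m))

  ∑-antidiagonal : ∀ n (F : ℕ → ℕ → ℤ) →
    ∑[ c < n ] ∑[ i < suc c ] F i (c ∸ i) ≡ ∑[ i < n ] ∑[ j < n ∸ i ] F i j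
  ∑-antidiagonal zero    F = refl
  ∑-antidiagonal (suc n) F = begin
    F 0 0 + + 0 + ∑[ c < n ] (F 0 (suc c) + ∑[ i < suc c ] F (suc i) (c ∸ i))
      ≡⟨ cong₂ _+_ (+-identityʳ (F 0 0)) (∑-distrib-+ n (F 0 ∘ suc) _) ⟩
    F 0 0 + (∑[ c < n ] F 0 (suc c) + ∑[ c < n ] ∑[ i < suc c ] F (suc i) (c ∸ i))
      ≡⟨ cong (λ z → F 0 0 + (∑[ c < n ] F 0 (suc c) + z)) (∑-antidiagonal n (F ∘ suc)) ⟩
    F 0 0 + (∑[ c < n ] F 0 (suc c) + ∑[ i < n ] ∑[ j < n ∸ i ] F (suc i) j)
      ≡⟨ +-assoc (F 0 0) _ _ ⟨
    ∑ (suc n) (F 0) + ∑[ i < n ] ∑[ j < n ∸ i ] F (suc i) j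
      ∎

  sumℤ-map-upTo : ∀ (h : ℕ → ℤ) n → sumℤ (map h (upTo n)) ≡ ∑ n h
  sumℤ-map-upTo h n = go h (λ i → i) n
    where
    go : ∀ (h : ℕ → ℤ) (g : ℕ → ℕ) n → sumℤ (map h (applyUpTo g n)) ≡ ∑[ i < n ] h (g i)
    go h g zero    = refl
    go h g (suc n) = cong (_+_ (h (g 0))) (go h (g ∘ suc) n)

  sumℤ-range : ∀ (h : ℕ → ℤ) lo hi → sumℤ (map h (range lo hi)) ≡ ∑[ i < suc hi ∸ lo ] h (lo ℕ.+ i)
  sumℤ-range h lo hi = trans (cong sumℤ (sym (map-∘ (upTo (suc hi ∸ lo))))) (sumℤ-map-upTo (h ∘ (lo ℕ.+_)) (suc hi ∸ lo))

  ∑-from : ∀ r n (h : ℕ → ℤ) → (∀ i → i < r → h i ≡ + 0) → ∑[ i < n ∸ r ] h (r ℕ.+ i) ≡ ∑ n h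
  ∑-from r n h vanish with r ℕ.≤? n
  ... | yes r≤n = begin
    ∑[ i < n ∸ r ] h (r ℕ.+ i)         ≡⟨ +-identityˡ _ ⟨
    + 0 + ∑[ i < n ∸ r ] h (r ℕ.+ i)   ≡⟨ cong (_+ ∑[ i < n ∸ r ] h (r ℕ.+ i)) (∑-zero r vanish) ⟨
    ∑ r h + ∑[ i < n ∸ r ] h (r ℕ.+ i) ≡⟨ ∑-split r (n ∸ r) h ⟨
    ∑ (r ℕ.+ (n ∸ r)) h                ≡⟨ cong (λ k → ∑ k h) (ℕ.m+[n∸m]≡n r≤n) ⟩
    ∑ n h                              ∎
  ... | no r≰n = begin
    ∑[ i < n ∸ r ] h (r ℕ.+ i) ≡⟨ cong (λ k → ∑[ i < k ] h (r ℕ.+ i)) (ℕ.m≤n⇒m∸n≡0 n≤r) ⟩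
    + 0                        ≡⟨ ∑-zero n (λ i i<n → vanish i (ℕ.<-≤-trans i<n n≤r)) ⟨
    ∑ n h                      ∎
    where
    n≤r : n ≤ r
    n≤r = ℕ.<⇒≤ (ℕ.≰⇒> r≰n)

  ∑-pascal : ∀ n (g : ℕ → ℤ) →
    ∑[ j < suc (suc n) ] (+ (suc n C j) * g j) ≡
    ∑[ j < suc n ] (+ (n C j) * g j) + ∑[ j < suc n ] (+ (n C j) * g (suc j))
  ∑-pascal n g = begin
    + 1 * g 0 + ∑[ j < suc n ] (+ (suc n C suc j) * g (suc j))
      ≡⟨ cong (_+_ (+ 1 * g 0)) (∑-cong (suc n) pascal) ⟩
    + 1 * g 0 + ∑[ j < suc n ] (+ (n C suc j) * g (suc j) + + (n C j) * g (suc j))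
      ≡⟨ cong (_+_ (+ 1 * g 0)) (∑-distrib-+ (suc n) (λ j → + (n C suc j) * g (suc j)) (λ j → + (n C j) * g (suc j))) ⟩
    + 1 * g 0 + (∑[ j < suc n ] (+ (n C suc j) * g (suc j)) + B)
      ≡⟨ +-assoc (+ 1 * g 0) _ _ ⟨
    ∑[ j < suc (suc n) ] (+ (n C j) * g j) + B
      ≡⟨ cong (_+ B) (∑-init-last (suc n) (λ j → + (n C j) * g j)) ⟩
    A + + (n C suc n) * g (suc n) + B
      ≡⟨ cong (λ c → A + + c * g (suc n) + B) (k>n⇒nCk≡0 (ℕ.n<1+n n)) ⟩
    A + + 0 * g (suc n) + B
      ≡⟨ cong (λ z → A + z + B) (*-zeroˡ (g (suc n))) ⟩
    A + + 0 + B
      ≡⟨ cong (_+ B) (+-identityʳ A) ⟩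
    A + B ∎
    where
    A B : ℤ
    A = ∑[ j < suc n ] (+ (n C j) * g j)
    B = ∑[ j < suc n ] (+ (n C j) * g (suc j))
    pascal : ∀ j → + (suc n C suc j) * g (suc j) ≡ + (n C suc j) * g (suc j) + + (n C j) * g (suc j)
    pascal j = begin
      + (suc n C suc j) * g (suc j)                     ≡⟨ cong (λ z → + z * g (suc j)) (nCk+nC[k+1]≡[n+1]C[k+1] n j) ⟨
      + (n C j ℕ.+ n C suc j) * g (suc j)               ≡⟨ cong (_* g (suc j)) (pos-+ (n C j) (n C suc j)) ⟩
      (+ (n C j) + + (n C suc j)) * g (suc j)           ≡⟨ cong (_* g (suc j)) (+-comm (+ (n C j)) (+ (n C suc j))) ⟩
      (+ (n C suc j) + + (n C j)) * g (suc j)           ≡⟨ *-distribʳ-+ (g (suc j)) (+ (n C suc j)) (+ (n C j)) ⟩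
      + (n C suc j) * g (suc j) + + (n C j) * g (suc j) ∎

  ∑-*-∑ : ∀ m n (f g : ℕ → ℤ) → ∑ m f * ∑ n g ≡ ∑[ i < m ] ∑[ j < n ] (f i * g j)
  ∑-*-∑ m n f g = begin
    ∑ m f * ∑ n g                   ≡⟨ ∑-distribʳ m (∑ n g) f ⟨
    ∑[ i < m ] (f i * ∑ n g)        ≡⟨ ∑-cong m (λ i → ∑-distribˡ n (f i) g) ⟨
    ∑[ i < m ] ∑[ j < n ] (f i * g j) ∎

  ∑-square-antidiagonal : ∀ n (F : ℕ → ℕ → ℤ) → (∀ i j → n < i ℕ.+ j → F i j ≡ + 0) →
    ∑[ i < suc n ] ∑[ j < suc n ] F i j ≡ ∑[ c < suc n ] ∑[ i < suc c ] F i (c ∸ i)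
  ∑-square-antidiagonal n F vanish = begin
    ∑[ i < suc n ] ∑[ j < suc n ] F i j        ≡⟨ ∑-cong-< (suc n) (λ i i<1+n → ∑-pad (suc n ∸ i) (suc n) (ℕ.m∸n≤m (suc n) i) (beyond i i<1+n)) ⟨
    ∑[ i < suc n ] ∑[ j < suc n ∸ i ] F i j    ≡⟨ ∑-antidiagonal (suc n) F ⟨
    ∑[ c < suc n ] ∑[ i < suc c ] F i (c ∸ i)  ∎
    where
    beyond : ∀ i → i < suc n → ∀ j → suc n ∸ i ≤ j → j < suc n → F i j ≡ + 0
    beyond i i<1+n j 1+n∸i≤j _ = vanish i j
      (subst₂ _≤_ (ℕ.m∸n+n≡m (ℕ.<⇒≤ i<1+n)) (ℕ.+-comm j i) (ℕ.+-monoˡ-≤ i 1+n∸i≤j))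

  module _ {A : Set} where

    sumℤ-map-++ : ∀ (w : A → ℤ) xs ys → sumℤ (map w (xs ++ ys)) ≡ sumℤ (map w xs) + sumℤ (map w ys)
    sumℤ-map-++ w []       ys = sym (+-identityˡ _)
    sumℤ-map-++ w (x ∷ xs) ys = trans (cong (_+_ (w x)) (sumℤ-map-++ w xs ys)) (sym (+-assoc (w x) _ _))

    sumℤ-map-cong : ∀ {w w′ : A → ℤ} {xs} → All (λ x → w x ≡ w′ x) xs → sumℤ (map w xs) ≡ sumℤ (map w′ xs)
    sumℤ-map-cong []       = refl
    sumℤ-map-cong (p ∷ ps) = cong₂ _+_ p (sumℤ-map-cong ps)

    sumℤ-map-zero : ∀ {w : A → ℤ} {xs} → All (λ x → w x ≡ + 0) xs → sumℤ (map w xs) ≡ + 0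
    sumℤ-map-zero []       = refl
    sumℤ-map-zero (p ∷ ps) = cong₂ _+_ p (sumℤ-map-zero ps)

    sumℤ-map-distribˡ : ∀ (c : ℤ) (w : A → ℤ) xs → sumℤ (map (λ x → c * w x) xs) ≡ c * sumℤ (map w xs)
    sumℤ-map-distribˡ c w []       = sym (*-zeroʳ c)
    sumℤ-map-distribˡ c w (x ∷ xs) = trans (cong (_+_ (c * w x)) (sumℤ-map-distribˡ c w xs)) (sym (*-distribˡ-+ c (w x) _))

module Binomial where

  open import Data.Nat
  open import Data.Nat.Properties
  open import Data.Nat.Combinatorics
  open import Data.Nat.DivMod using (m/n*n≡m)
  open import Data.Nat.Tactic.RingSolver using (solve-∀)
  open import Relation.Nullary using (yes; no)
  open import Relation.Binary.PropositionalEquality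
  open ≡-Reasoning

  nCk*k!*[n∸k]!≡n! : ∀ {n k} → k ≤ n → (n C k) * (k ! * (n ∸ k) !) ≡ n !
  nCk*k!*[n∸k]!≡n! {n} {k} k≤n = begin
    (n C k) * (k ! * (n ∸ k) !)                   ≡⟨ cong (_* (k ! * (n ∸ k) !)) (nCk≡n!/k![n-k]! k≤n) ⟩
    (n ! / (k ! * (n ∸ k) !)) * (k ! * (n ∸ k) !) ≡⟨ m/n*n≡m (k![n∸k]!∣n! k≤n) ⟩
    n !                                           ∎
    where instance _ = k !* (n ∸ k) !≢0

  private
    cancel-! : ∀ {x y} d → x * d ! ≡ y * d ! → x ≡ y
    cancel-! {x} {y} d = *-cancelʳ-≡ x y (d !) {{d !≢0}}

  [a+b]Ca≡[a+b]Cb : ∀ a b → (a + b) C a ≡ (a + b) C b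
  [a+b]Ca≡[a+b]Cb a b = begin
    (a + b) C a           ≡⟨ nCk≡nC[n∸k] (m≤m+n a b) ⟩
    (a + b) C (a + b ∸ a) ≡⟨ cong ((a + b) C_) (m+n∸m≡n a b) ⟩
    (a + b) C b           ∎

  [n+1]C[k+1]*[k+1]≡[n+1]*nCk : ∀ n k → (suc n C suc k) * suc k ≡ suc n * (n C k)
  [n+1]C[k+1]*[k+1]≡[n+1]*nCk n k with k ≤? n
  ... | yes k≤n = cancel-! (n ∸ k) (cancel-! k (begin
    (suc n C suc k) * suc k * (n ∸ k) ! * k ! ≡⟨ regroup (suc n C suc k) k (k !) ((n ∸ k) !) ⟩
    (suc n C suc k) * (suc k ! * (n ∸ k) !)   ≡⟨ nCk*k!*[n∸k]!≡n! (s≤s k≤n) ⟩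
    suc n !                                   ≡⟨ cong (suc n *_) (nCk*k!*[n∸k]!≡n! k≤n) ⟨
    suc n * ((n C k) * (k ! * (n ∸ k) !))     ≡⟨ regroup′ (suc n) (n C k) (k !) ((n ∸ k) !) ⟩
    suc n * (n C k) * (n ∸ k) ! * k !         ∎))
    where
    regroup : ∀ c k x y → c * suc k * y * x ≡ c * ((suc k * x) * y)
    regroup = solve-∀
    regroup′ : ∀ m c x y → m * (c * (x * y)) ≡ m * c * y * x
    regroup′ = solve-∀
  ... | no k≰n = begin
    (suc n C suc k) * suc k ≡⟨ cong (_* suc k) (k>n⇒nCk≡0 (s≤s (≰⇒> k≰n))) ⟩
    0                       ≡⟨ *-zeroʳ (suc n) ⟨
    suc n * 0               ≡⟨ cong (suc n *_) (k>n⇒nCk≡0 (≰⇒> k≰n)) ⟨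
    suc n * (n C k)         ∎

  nCa*[n∸a]Cb≡nC[a+b]*[a+b]Ca : ∀ n a b → (n C a) * ((n ∸ a) C b) ≡ (n C (a + b)) * ((a + b) C a)
  nCa*[n∸a]Cb≡nC[a+b]*[a+b]Ca n a b with a + b ≤? n
  ... | yes a+b≤n = cancel-! a (cancel-! b (cancel-! (n ∸ (a + b)) (begin
    (n C a) * ((n ∸ a) C b) * a ! * b ! * W !
      ≡⟨ regroup (n C a) ((n ∸ a) C b) (a !) (b !) (W !) ⟩
    (n C a) * (a ! * (((n ∸ a) C b) * (b ! * W !)))
      ≡⟨ cong (λ z → (n C a) * (a ! * (((n ∸ a) C b) * (b ! * z !)))) (∸-+-assoc n a b) ⟨
    (n C a) * (a ! * (((n ∸ a) C b) * (b ! * (n ∸ a ∸ b) !)))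
      ≡⟨ cong (λ z → (n C a) * (a ! * z)) (nCk*k!*[n∸k]!≡n! b≤n∸a) ⟩
    (n C a) * (a ! * (n ∸ a) !)
      ≡⟨ nCk*k!*[n∸k]!≡n! a≤n ⟩
    n !
      ≡⟨ nCk*k!*[n∸k]!≡n! a+b≤n ⟨
    (n C (a + b)) * ((a + b) ! * W !)
      ≡⟨ cong (λ z → (n C (a + b)) * (z * W !)) (nCk*k!*[n∸k]!≡n! (m≤m+n a b)) ⟨
    (n C (a + b)) * (((a + b) C a) * (a ! * (a + b ∸ a) !) * W !)
      ≡⟨ cong (λ z → (n C (a + b)) * (((a + b) C a) * (a ! * z !) * W !)) (m+n∸m≡n a b) ⟩
    (n C (a + b)) * (((a + b) C a) * (a ! * b !) * W !)
      ≡⟨ regroup′ (n C (a + b)) ((a + b) C a) (a !) (b !) (W !) ⟩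
    (n C (a + b)) * ((a + b) C a) * a ! * b ! * W ! ∎)))
    where
    W = n ∸ (a + b)
    a≤n : a ≤ n
    a≤n = ≤-trans (m≤m+n a b) a+b≤n
    b≤n∸a : b ≤ n ∸ a
    b≤n∸a = subst (_≤ n ∸ a) (m+n∸m≡n a b) (∸-monoˡ-≤ a a+b≤n)
    regroup : ∀ p q x y z → p * q * x * y * z ≡ p * (x * (q * (y * z)))
    regroup = solve-∀
    regroup′ : ∀ p q x y z → p * (q * (x * y) * z) ≡ p * q * x * y * z
    regroup′ = solve-∀
  ... | no a+b≰n with a ≤? n
  ...   | yes a≤n = begin
    (n C a) * ((n ∸ a) C b)       ≡⟨ cong ((n C a) *_) (k>n⇒nCk≡0 n∸a<b) ⟩
    (n C a) * 0                   ≡⟨ *-zeroʳ (n C a) ⟩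
    0                             ≡⟨ cong (_* ((a + b) C a)) (k>n⇒nCk≡0 (≰⇒> a+b≰n)) ⟨
    (n C (a + b)) * ((a + b) C a) ∎
    where
    n∸a<b : n ∸ a < b
    n∸a<b = subst (n ∸ a <_) (m+n∸m≡n a b) (∸-monoˡ-< (≰⇒> a+b≰n) a≤n)
  ...   | no a≰n = begin
    (n C a) * ((n ∸ a) C b)       ≡⟨ cong (_* ((n ∸ a) C b)) (k>n⇒nCk≡0 (≰⇒> a≰n)) ⟩
    0                             ≡⟨ cong (_* ((a + b) C a)) (k>n⇒nCk≡0 (≰⇒> a+b≰n)) ⟨
    (n C (a + b)) * ((a + b) C a) ∎

  nCa*[n∸a]Cb≡nCb*[n∸b]Ca : ∀ n a b → (n C a) * ((n ∸ a) C b) ≡ (n C b) * ((n ∸ b) C a)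
  nCa*[n∸a]Cb≡nCb*[n∸b]Ca n a b = begin
    (n C a) * ((n ∸ a) C b)       ≡⟨ nCa*[n∸a]Cb≡nC[a+b]*[a+b]Ca n a b ⟩
    (n C (a + b)) * ((a + b) C a) ≡⟨ cong₂ (λ x y → (n C x) * y) (+-comm a b) (trans ([a+b]Ca≡[a+b]Cb a b) (cong (_C b) (+-comm a b))) ⟩
    (n C (b + a)) * ((b + a) C b) ≡⟨ nCa*[n∸a]Cb≡nC[a+b]*[a+b]Ca n b a ⟨
    (n C b) * ((n ∸ b) C a)       ∎

module Stirling where

  open import Data.Nat as ℕ using (ℕ; zero; suc; _∸_; _<_; _≤_; s≤s)
  import Data.Nat.Properties as ℕ
  open import Data.Nat.Combinatorics using (_C_; nCn≡1; nCk+nC[k+1]≡[n+1]C[k+1])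
  open import Data.Integer using (ℤ; +_; _+_; _*_; -_; _^_)
  open import Data.Integer.Properties
  open import Data.Integer.Tactic.RingSolver using (solve-∀)
  open import Data.List using ([]; _∷_; _∷ʳ_; length; map; upTo)
  import Data.List.Properties as List
  open import Relation.Binary.PropositionalEquality
  open ≡-Reasoning
  open Sum

  coeff-⊕ : ∀ p q b → coeff (p ⊕ q) b ≡ coeff p b + coeff q b
  coeff-⊕ []      q       b       = sym (+-identityˡ _)
  coeff-⊕ (x ∷ p) []      b       = sym (+-identityʳ _)
  coeff-⊕ (x ∷ p) (y ∷ q) zero    = refl
  coeff-⊕ (x ∷ p) (y ∷ q) (suc b) = coeff-⊕ p q b

  coeff-scale : ∀ c p b → coeff (scale c p) b ≡ c * coeff p b
  coeff-scale c []      b       = sym (*-zeroʳ c)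
  coeff-scale c (x ∷ p) zero    = refl
  coeff-scale c (x ∷ p) (suc b) = coeff-scale c p b

  -- s′ a c is the coefficient of x^c in x·(x)_a.
  s′ : ℕ → ℕ → ℤ
  s′ a zero    = + 0
  s′ a (suc c) = s a c

  s-suc : ∀ a c → s (suc a) c ≡ s′ a c + - + a * s a c
  s-suc a c = begin
    coeff ((+ 0 ∷ fallingFactorial a) ⊕ scale (- + a) (fallingFactorial a)) c
      ≡⟨ coeff-⊕ (+ 0 ∷ fallingFactorial a) (scale (- + a) (fallingFactorial a)) c ⟩
    coeff (+ 0 ∷ fallingFactorial a) c + coeff (scale (- + a) (fallingFactorial a)) c
      ≡⟨ cong₂ _+_ (shift c) (coeff-scale (- + a) (fallingFactorial a) c) ⟩
    s′ a c + - + a * s a c ∎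
    where
    shift : ∀ c → coeff (+ 0 ∷ fallingFactorial a) c ≡ s′ a c
    shift zero    = refl
    shift (suc c) = refl

  a<c⇒s≡0 : ∀ {a c} → a < c → s a c ≡ + 0
  a<c⇒s≡0 {zero}  {suc c} _         = refl
  a<c⇒s≡0 {suc a} {suc c} (s≤s a<c) = begin
    s (suc a) (suc c)              ≡⟨ s-suc a (suc c) ⟩
    s a c + - + a * s a (suc c)    ≡⟨ cong₂ (λ x y → x + - + a * y) (a<c⇒s≡0 a<c) (a<c⇒s≡0 (ℕ.m<n⇒m<1+n a<c)) ⟩
    + 0 + - + a * + 0              ≡⟨ cong (_+_ (+ 0)) (*-zeroʳ (- + a)) ⟩
    + 0                            ∎

  s-diag : ∀ a → s a a ≡ + 1
  s-diag zero    = refl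
  s-diag (suc a) = begin
    s (suc a) (suc a)           ≡⟨ s-suc a (suc a) ⟩
    s a a + - + a * s a (suc a) ≡⟨ cong₂ (λ x y → x + - + a * y) (s-diag a) (a<c⇒s≡0 (ℕ.n<1+n a)) ⟩
    + 1 + - + a * + 0           ≡⟨ cong (_+_ (+ 1)) (*-zeroʳ (- + a)) ⟩
    + 1                         ∎

  s-suc-zero : ∀ a → s (suc a) 0 ≡ + 0
  s-suc-zero zero    = refl
  s-suc-zero (suc a) = begin
    s (suc (suc a)) 0                 ≡⟨ s-suc (suc a) 0 ⟩
    + 0 + - + suc a * s (suc a) 0     ≡⟨ cong (λ y → + 0 + - + suc a * y) (s-suc-zero a) ⟩
    + 0 + - + suc a * + 0             ≡⟨ cong (_+_ (+ 0)) (*-zeroʳ (- + suc a)) ⟩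
    + 0                               ∎

  sConvolution : ℕ → ℕ → ℕ → ℤ
  sConvolution n a b = ∑[ j < suc n ] (+ (n C j) * (s j a * s (n ∸ j) b))

  shiftedConvolution : ℕ → ℕ → ℕ → ℤ
  shiftedConvolution n a b =
    ∑[ j < suc n ] (+ (n C j) * (s j a * s′ (n ∸ j) b)) + ∑[ j < suc n ] (+ (n C j) * (s′ j a * s (n ∸ j) b))

  sConvolution-suc : ∀ n a b → sConvolution (suc n) a b ≡ shiftedConvolution n a b + - + n * sConvolution n a b
  sConvolution-suc n a b = begin
    sConvolution (suc n) a b
      ≡⟨ ∑-pascal n g ⟩
    ∑[ j < suc n ] (+ (n C j) * g j) + ∑[ j < suc n ] (+ (n C j) * g (suc j))
      ≡⟨ ∑-distrib-+ (suc n) (λ j → + (n C j) * g j) (λ j → + (n C j) * g (suc j)) ⟨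
    ∑[ j < suc n ] (+ (n C j) * g j + + (n C j) * g (suc j))
      ≡⟨ ∑-cong-< (suc n) (λ j j<1+n → term j (ℕ.≤-pred j<1+n)) ⟩
    ∑[ j < suc n ] (+ (n C j) * X j + + (n C j) * Y j + - + n * (+ (n C j) * Z j))
      ≡⟨ ∑-distrib-+ (suc n) (λ j → + (n C j) * X j + + (n C j) * Y j) (λ j → - + n * (+ (n C j) * Z j)) ⟩
    ∑[ j < suc n ] (+ (n C j) * X j + + (n C j) * Y j) + ∑[ j < suc n ] (- + n * (+ (n C j) * Z j))
      ≡⟨ cong₂ _+_ (∑-distrib-+ (suc n) (λ j → + (n C j) * X j) (λ j → + (n C j) * Y j))
                   (∑-distribˡ (suc n) (- + n) (λ j → + (n C j) * Z j)) ⟩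
    shiftedConvolution n a b + - + n * sConvolution n a b ∎
    where
    g X Y Z : ℕ → ℤ
    g j = s j a * s (suc n ∸ j) b
    X j = s j a * s′ (n ∸ j) b
    Y j = s′ j a * s (n ∸ j) b
    Z j = s j a * s (n ∸ j) b
    expand : ∀ c x y p q m k → c * (x * (p + - m * y)) + c * ((q + - k * x) * y) ≡
                               c * (x * p) + c * (q * y) + - (m + k) * (c * (x * y))
    expand = solve-∀
    term : ∀ j → j ≤ n → + (n C j) * g j + + (n C j) * g (suc j) ≡ + (n C j) * X j + + (n C j) * Y j + - + n * (+ (n C j) * Z j)
    term j j≤n = begin
      + (n C j) * (s j a * s (suc n ∸ j) b) + + (n C j) * (s (suc j) a * s (n ∸ j) b)
        ≡⟨ cong₂ (λ u v → + (n C j) * (s j a * u) + + (n C j) * (v * s (n ∸ j) b))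
                 (trans (cong (λ m → s m b) (ℕ.+-∸-assoc 1 j≤n)) (s-suc (n ∸ j) b)) (s-suc j a) ⟩
      + (n C j) * (s j a * (s′ (n ∸ j) b + - + (n ∸ j) * s (n ∸ j) b)) + + (n C j) * ((s′ j a + - + j * s j a) * s (n ∸ j) b)
        ≡⟨ expand (+ (n C j)) (s j a) (s (n ∸ j) b) (s′ (n ∸ j) b) (s′ j a) (+ (n ∸ j)) (+ j) ⟩
      + (n C j) * X j + + (n C j) * Y j + - (+ (n ∸ j) + + j) * (+ (n C j) * Z j)
        ≡⟨ cong (λ m → + (n C j) * X j + + (n C j) * Y j + - m * (+ (n C j) * Z j))
                (trans (sym (pos-+ (n ∸ j) j)) (cong +_ (ℕ.m∸n+n≡m j≤n))) ⟩
      + (n C j) * X j + + (n C j) * Y j + - + n * (+ (n C j) * Z j) ∎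

  private
    shift-right-zero : ∀ n a → ∑[ j < suc n ] (+ (n C j) * (s j a * s′ (n ∸ j) 0)) ≡ + 0
    shift-right-zero n a = ∑-zero (suc n) (λ j _ → trans (cong (+ (n C j) *_) (*-zeroʳ (s j a))) (*-zeroʳ (+ (n C j))))

    shift-left-zero : ∀ n b → ∑[ j < suc n ] (+ (n C j) * (s′ j 0 * s (n ∸ j) b)) ≡ + 0
    shift-left-zero n b = ∑-zero (suc n) (λ j _ → *-zeroʳ (+ (n C j)))

  shiftedConvolution-≡ : ∀ n → (∀ a b → + ((a ℕ.+ b) C a) * s n (a ℕ.+ b) ≡ sConvolution n a b) →
                         ∀ a b → shiftedConvolution n a b ≡ + ((a ℕ.+ b) C a) * s′ n (a ℕ.+ b)
  shiftedConvolution-≡ n vandermonde zero zero = cong₂ _+_ (shift-right-zero n 0) (shift-left-zero n 0)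
  shiftedConvolution-≡ n vandermonde zero (suc b) = begin
    sConvolution n 0 b + ∑[ j < suc n ] (+ (n C j) * (s′ j 0 * s (n ∸ j) (suc b)))
      ≡⟨ cong (_+_ (sConvolution n 0 b)) (shift-left-zero n (suc b)) ⟩
    sConvolution n 0 b + + 0  ≡⟨ +-identityʳ _ ⟩
    sConvolution n 0 b        ≡⟨ vandermonde 0 b ⟨
    + 1 * s n b               ∎
  shiftedConvolution-≡ n vandermonde (suc a) zero = begin
    ∑[ j < suc n ] (+ (n C j) * (s j (suc a) * + 0)) + sConvolution n a 0
      ≡⟨ cong (_+ sConvolution n a 0) (shift-right-zero n (suc a)) ⟩
    + 0 + sConvolution n a 0                   ≡⟨ +-identityˡ _ ⟩
    sConvolution n a 0                         ≡⟨ vandermonde a 0 ⟨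
    + ((a ℕ.+ 0) C a) * s n (a ℕ.+ 0)          ≡⟨ cong (λ c → + c * s n (a ℕ.+ 0)) (trans ([a+0]Ca≡1 a) (sym ([a+0]Ca≡1 (suc a)))) ⟩
    + ((suc a ℕ.+ 0) C suc a) * s n (a ℕ.+ 0)  ∎
    where
    [a+0]Ca≡1 : ∀ a → (a ℕ.+ 0) C a ≡ 1
    [a+0]Ca≡1 a = subst (λ m → m C a ≡ 1) (sym (ℕ.+-identityʳ a)) (nCn≡1 a)
  shiftedConvolution-≡ n vandermonde (suc a) (suc b) = begin
    sConvolution n (suc a) b + sConvolution n a (suc b)
      ≡⟨ cong₂ _+_ (vandermonde (suc a) b) (vandermonde a (suc b)) ⟨
    + (suc (a ℕ.+ b) C suc a) * s n (suc (a ℕ.+ b)) + + (m C a) * s n m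
      ≡⟨ cong (λ k → + (k C suc a) * s n k + + (m C a) * s n m) (ℕ.+-suc a b) ⟨
    + (m C suc a) * s n m + + (m C a) * s n m
      ≡⟨ *-distribʳ-+ (s n m) (+ (m C suc a)) (+ (m C a)) ⟨
    (+ (m C suc a) + + (m C a)) * s n m
      ≡⟨ cong (λ c → c * s n m) (trans (+-comm (+ (m C suc a)) (+ (m C a))) (sym (pos-+ (m C a) (m C suc a)))) ⟩
    + (m C a ℕ.+ m C suc a) * s n m
      ≡⟨ cong (λ c → + c * s n m) (nCk+nC[k+1]≡[n+1]C[k+1] m a) ⟩
    + (suc m C suc a) * s n m ∎
    where
    m = a ℕ.+ suc b

  -- Coefficientwise form of Vandermonde's identity (x + y)_n = Σ_j C(n,j) (x)_j (y)_(n-j).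
  s-vandermonde : ∀ n a b → + ((a ℕ.+ b) C a) * s n (a ℕ.+ b) ≡ sConvolution n a b
  s-vandermonde zero    zero    zero    = refl
  s-vandermonde zero    zero    (suc b) = refl
  s-vandermonde zero    (suc a) b       = begin
    + ((suc a ℕ.+ b) C suc a) * + 0 ≡⟨ *-zeroʳ (+ ((suc a ℕ.+ b) C suc a)) ⟩
    + 0                             ≡⟨ trans (+-identityʳ _) (*-zeroʳ (+ 1)) ⟨
    + 1 * (+ 0 * s 0 b) + + 0       ∎
  s-vandermonde (suc n) a b = begin
    + c * s (suc n) (a ℕ.+ b)
      ≡⟨ cong (+ c *_) (s-suc n (a ℕ.+ b)) ⟩
    + c * (s′ n (a ℕ.+ b) + - + n * s n (a ℕ.+ b))
      ≡⟨ distribute (+ c) (s′ n (a ℕ.+ b)) (+ n) (s n (a ℕ.+ b)) ⟩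
    + c * s′ n (a ℕ.+ b) + - + n * (+ c * s n (a ℕ.+ b))
      ≡⟨ cong₂ (λ u v → u + - + n * v) (sym (shiftedConvolution-≡ n (s-vandermonde n) a b)) (s-vandermonde n a b) ⟩
    shiftedConvolution n a b + - + n * sConvolution n a b
      ≡⟨ sConvolution-suc n a b ⟨
    sConvolution (suc n) a b ∎
    where
    c = (a ℕ.+ b) C a
    distribute : ∀ c p m q → c * (p + - m * q) ≡ c * p + - m * (c * q)
    distribute = solve-∀

  e-∷ʳ : ∀ m xs x → e (suc m) (xs ∷ʳ x) ≡ e (suc m) xs + x * e m xs
  e-∷ʳ m       []       x = refl
  e-∷ʳ zero    (y ∷ ys) x = begin
    e 1 (ys ∷ʳ x) + y * + 1          ≡⟨ cong (_+ y * + 1) (e-∷ʳ zero ys x) ⟩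
    e 1 ys + x * + 1 + y * + 1       ≡⟨ swap (e 1 ys) x y ⟩
    e 1 ys + y * + 1 + x * + 1       ∎
    where
    swap : ∀ E x y → E + x * + 1 + y * + 1 ≡ E + y * + 1 + x * + 1
    swap = solve-∀
  e-∷ʳ (suc m) (y ∷ ys) x = begin
    e (suc (suc m)) (ys ∷ʳ x) + y * e (suc m) (ys ∷ʳ x)
      ≡⟨ cong₂ (λ p q → p + y * q) (e-∷ʳ (suc m) ys x) (e-∷ʳ m ys x) ⟩
    (e (suc (suc m)) ys + x * e (suc m) ys) + y * (e (suc m) ys + x * e m ys)
      ≡⟨ swap (e (suc (suc m)) ys) (e (suc m) ys) (e m ys) x y ⟩
    (e (suc (suc m)) ys + y * e (suc m) ys) + x * (e (suc m) ys + y * e m ys) ∎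
    where
    swap : ∀ E₂ E₁ E₀ x y → (E₂ + x * E₁) + y * (E₁ + x * E₀) ≡ (E₂ + y * E₁) + x * (E₁ + y * E₀)
    swap = solve-∀

  length<m⇒e≡0 : ∀ m xs → length xs < m → e m xs ≡ + 0
  length<m⇒e≡0 (suc m)       []       _             = refl
  length<m⇒e≡0 (suc (suc m)) (x ∷ xs) (s≤s len<m) = begin
    e (suc (suc m)) xs + x * e (suc m) xs ≡⟨ cong₂ (λ p q → p + x * q) (length<m⇒e≡0 (suc (suc m)) xs (ℕ.m<n⇒m<1+n len<m)) (length<m⇒e≡0 (suc m) xs len<m) ⟩
    + 0 + x * + 0                         ≡⟨ cong (_+_ (+ 0)) (*-zeroʳ x) ⟩
    + 0                                   ∎

  oneTo-suc : ∀ N → oneTo (suc N) ≡ oneTo N ∷ʳ + suc N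
  oneTo-suc N = begin
    map (λ i → + i) (map suc (upTo (suc N)))          ≡⟨ cong (λ z → map (λ i → + i) (map suc z)) (List.upTo-∷ʳ N) ⟨
    map (λ i → + i) (map suc (upTo N ∷ʳ N))           ≡⟨ cong (map (λ i → + i)) (List.map-++ suc (upTo N) (N ∷ [])) ⟩
    map (λ i → + i) (map suc (upTo N) ∷ʳ suc N)       ≡⟨ List.map-++ (λ i → + i) (map suc (upTo N)) (suc N ∷ []) ⟩
    oneTo N ∷ʳ + suc N                       ∎

  length-oneTo : ∀ N → length (oneTo N) ≡ N
  length-oneTo N = trans (List.length-map (λ i → + i) (map suc (upTo N))) (trans (List.length-map suc (upTo N)) (List.length-upTo N))

  s[r+d,r]≡[-1]^d*e[d] : ∀ r d → s (r ℕ.+ d) r ≡ (- + 1) ^ d * e d (oneTo (r ℕ.+ d ∸ 1))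
  s[r+d,r]≡[-1]^d*e[d] r       zero    = trans (cong (λ a → s a r) (ℕ.+-identityʳ r)) (s-diag r)
  s[r+d,r]≡[-1]^d*e[d] zero    (suc d) = begin
    s (suc d) 0                               ≡⟨ s-suc-zero d ⟩
    + 0                                       ≡⟨ *-zeroʳ ((- + 1) ^ suc d) ⟨
    (- + 1) ^ suc d * + 0                     ≡⟨ cong ((- + 1) ^ suc d *_) (length<m⇒e≡0 (suc d) (oneTo d) (subst (_< suc d) (sym (length-oneTo d)) (ℕ.n<1+n d))) ⟨
    (- + 1) ^ suc d * e (suc d) (oneTo d)     ∎
  s[r+d,r]≡[-1]^d*e[d] (suc r) (suc d) = begin
    s (suc r ℕ.+ suc d) (suc r)
      ≡⟨ cong (λ a → s a (suc r)) (ℕ.+-suc (suc r) d) ⟩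
    s (suc (suc r ℕ.+ d)) (suc r)
      ≡⟨ s-suc (suc r ℕ.+ d) (suc r) ⟩
    s (suc (r ℕ.+ d)) r + - N * s (suc r ℕ.+ d) (suc r)
      ≡⟨ cong (λ a → s a r + - N * s (suc r ℕ.+ d) (suc r)) (ℕ.+-suc r d) ⟨
    s (r ℕ.+ suc d) r + - N * s (suc r ℕ.+ d) (suc r)
      ≡⟨ cong₂ (λ p q → p + - N * q) (s[r+d,r]≡[-1]^d*e[d] r (suc d)) (s[r+d,r]≡[-1]^d*e[d] (suc r) d) ⟩
    (- + 1) ^ suc d * e (suc d) (oneTo (r ℕ.+ suc d ∸ 1)) + - N * ((- + 1) ^ d * e d L)
      ≡⟨ cong (λ a → (- + 1) ^ suc d * e (suc d) (oneTo (a ∸ 1)) + - N * ((- + 1) ^ d * e d L)) (ℕ.+-suc r d) ⟩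
    (- + 1) * (- + 1) ^ d * e (suc d) L + - N * ((- + 1) ^ d * e d L)
      ≡⟨ factor ((- + 1) ^ d) (e (suc d) L) (e d L) N ⟩
    (- + 1) ^ suc d * (e (suc d) L + N * e d L)
      ≡⟨ cong ((- + 1) ^ suc d *_) (e-∷ʳ d L N) ⟨
    (- + 1) ^ suc d * e (suc d) (L ∷ʳ N)
      ≡⟨ cong (λ l → (- + 1) ^ suc d * e (suc d) l) (oneTo-suc (r ℕ.+ d)) ⟨
    (- + 1) ^ suc d * e (suc d) (oneTo (suc (r ℕ.+ d)))
      ≡⟨ cong (λ a → (- + 1) ^ suc d * e (suc d) (oneTo a)) (ℕ.+-suc r d) ⟨
    (- + 1) ^ suc d * e (suc d) (oneTo (suc r ℕ.+ suc d ∸ 1)) ∎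
    where
    N = + suc (r ℕ.+ d)
    L = oneTo (r ℕ.+ d)
    factor : ∀ p E₁ E₀ N → (- + 1) * p * E₁ + - N * (p * E₀) ≡ (- + 1) * p * (E₁ + N * E₀)
    factor = solve-∀

module IteratedStirling where

  open import Data.Nat as ℕ using (ℕ; zero; suc; _∸_; _<_; _≤_; s≤s)
  import Data.Nat.Properties as ℕ
  open import Data.Nat.Combinatorics using (_C_; nC1≡n)
  open import Data.Integer using (ℤ; +_; _+_; _*_)
  open import Data.Integer.Properties
  open import Data.Integer.Tactic.RingSolver using (solve-∀)
  open import Relation.Binary.PropositionalEquality
  open ≡-Reasoning
  open Sum
  open Stirling

  infixl 7 _⊙_

  _⊙_ : (ℕ → ℕ → ℤ) → (ℕ → ℕ → ℤ) → ℕ → ℕ → ℤ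
  (X ⊙ Y) n r = ∑[ i < suc n ] (X n i * Y i r)

  LowerTriangular : (ℕ → ℕ → ℤ) → Set
  LowerTriangular X = ∀ {n r} → n < r → X n r ≡ + 0

  ⊙-pad : ∀ X Y → LowerTriangular X → ∀ {j n} r → j ≤ n → (X ⊙ Y) j r ≡ ∑[ i < suc n ] (X j i * Y i r)
  ⊙-pad X Y lowerX r j≤n = ∑-pad _ _ (s≤s j≤n) (λ i j<i _ → trans (cong (_* Y i r) (lowerX j<i)) (*-zeroˡ (Y i r)))

  ⊙-assoc : ∀ X Y Z → LowerTriangular Y → ∀ n r → ((X ⊙ Y) ⊙ Z) n r ≡ (X ⊙ (Y ⊙ Z)) n r
  ⊙-assoc X Y Z lowerY n r = begin
    ∑[ i < suc n ] (∑[ j < suc n ] (X n j * Y j i) * Z i r)   ≡⟨ ∑-cong (suc n) (λ i → ∑-distribʳ (suc n) (Z i r) (λ j → X n j * Y j i)) ⟨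
    ∑[ i < suc n ] ∑[ j < suc n ] (X n j * Y j i * Z i r)     ≡⟨ ∑-comm (suc n) (suc n) (λ i j → X n j * Y j i * Z i r) ⟩
    ∑[ j < suc n ] ∑[ i < suc n ] (X n j * Y j i * Z i r)     ≡⟨ ∑-cong-< (suc n) (λ j j<1+n → row j (ℕ.≤-pred j<1+n)) ⟩
    ∑[ j < suc n ] (X n j * (Y ⊙ Z) j r)                      ∎
    where
    row : ∀ j → j ≤ n → ∑[ i < suc n ] (X n j * Y j i * Z i r) ≡ X n j * (Y ⊙ Z) j r
    row j j≤n = begin
      ∑[ i < suc n ] (X n j * Y j i * Z i r)   ≡⟨ ∑-cong (suc n) (λ i → *-assoc (X n j) (Y j i) (Z i r)) ⟩
      ∑[ i < suc n ] (X n j * (Y j i * Z i r)) ≡⟨ ∑-distribˡ (suc n) (X n j) (λ i → Y j i * Z i r) ⟩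
      X n j * ∑[ i < suc n ] (Y j i * Z i r)   ≡⟨ cong (X n j *_) (⊙-pad Y Z lowerY r j≤n) ⟨
      X n j * (Y ⊙ Z) j r                      ∎

  -- T k = S^(k+1) for the Stirling matrix S = (s(n,r)).
  T : ℕ → ℕ → ℕ → ℤ
  T k n r = t n (suc k) r

  T-lowerTriangular : ∀ k → LowerTriangular (T k)
  T-lowerTriangular zero    n<r = a<c⇒s≡0 n<r
  T-lowerTriangular (suc k) {n} {r} n<r = begin
    t n (suc (suc k)) r
      ≡⟨ sumℤ-range (λ i → s n i * t i (suc k) r) r n ⟩
    ∑[ i < suc n ∸ r ] (s n (r ℕ.+ i) * T k (r ℕ.+ i) r)
      ≡⟨ cong (λ m → ∑[ i < m ] (s n (r ℕ.+ i) * T k (r ℕ.+ i) r)) (ℕ.m≤n⇒m∸n≡0 n<r) ⟩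
    + 0 ∎

  T-suc : ∀ k n r → T (suc k) n r ≡ (s ⊙ T k) n r
  T-suc k n r = trans (sumℤ-range (λ i → s n i * T k i r) r n)
    (∑-from r (suc n) (λ i → s n i * T k i r) (λ i i<r → trans (cong (s n i *_) (T-lowerTriangular k i<r)) (*-zeroʳ (s n i))))

  T-comm : ∀ k n r → (T k ⊙ s) n r ≡ (s ⊙ T k) n r
  T-comm zero    n r = refl
  T-comm (suc k) n r = begin
    (T (suc k) ⊙ s) n r  ≡⟨ ∑-cong (suc n) (λ i → cong (_* s i r) (T-suc k n i)) ⟩
    (s ⊙ T k ⊙ s) n r    ≡⟨ ⊙-assoc s (T k) s (T-lowerTriangular k) n r ⟩
    (s ⊙ (T k ⊙ s)) n r  ≡⟨ ∑-cong (suc n) (λ i → cong (s n i *_) (T-comm k i r)) ⟩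
    (s ⊙ (s ⊙ T k)) n r  ≡⟨ ∑-cong (suc n) (λ i → cong (s n i *_) (T-suc k i r)) ⟨
    (s ⊙ T (suc k)) n r  ∎

  T-zero-zero : ∀ k → T k 0 0 ≡ + 1
  T-zero-zero zero    = refl
  T-zero-zero (suc k) = trans (T-suc k 0 0) (cong (λ x → + 1 * x + + 0) (T-zero-zero k))

  T-suc-zero : ∀ k n → T k (suc n) 0 ≡ + 0
  T-suc-zero zero    n = s-suc-zero n
  T-suc-zero (suc k) n = trans (T-suc k (suc n) 0) (∑-zero (suc (suc n)) vanish)
    where
    vanish : ∀ i → i < suc (suc n) → s (suc n) i * T k i 0 ≡ + 0
    vanish zero    _ = trans (cong (_* T k 0 0) (s-suc-zero n)) (*-zeroˡ (T k 0 0))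
    vanish (suc i) _ = trans (cong (s (suc n) (suc i) *_) (T-suc-zero k i)) (*-zeroʳ (s (suc n) (suc i)))

  Convolutive : (ℕ → ℕ → ℤ) → Set
  Convolutive X = ∀ n a → + suc a * X n (suc a) ≡ ∑[ j < suc n ] (+ (n C j) * (X j 1 * X (n ∸ j) a))

  s-convolutive : Convolutive s
  s-convolutive n a = trans (cong (λ c → + c * s n (suc a)) (sym (nC1≡n (suc a)))) (s-vandermonde n 1 a)

  private
    s⊙-convolution : ∀ X n a →
      ∑[ j < suc n ] (+ (n C j) * ((s ⊙ X) j 1 * (s ⊙ X) (n ∸ j) a)) ≡
      ∑[ i < suc n ] ∑[ i′ < suc n ] (X i 1 * X i′ a * sConvolution n i i′)
    s⊙-convolution X n a = begin
      ∑[ j < suc n ] (+ (n C j) * ((s ⊙ X) j 1 * (s ⊙ X) (n ∸ j) a))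
        ≡⟨ ∑-cong-< (suc n) (λ j j<1+n → cong (+ (n C j) *_) (cong₂ _*_ (⊙-pad s X a<c⇒s≡0 1 (ℕ.≤-pred j<1+n))
                                                                        (⊙-pad s X a<c⇒s≡0 a (ℕ.m∸n≤m n j)))) ⟩
      ∑[ j < suc n ] (+ (n C j) * (∑[ i < suc n ] (s j i * X i 1) * ∑[ i′ < suc n ] (s (n ∸ j) i′ * X i′ a)))
        ≡⟨ ∑-cong (suc n) (λ j → trans (cong (+ (n C j) *_) (∑-*-∑ (suc n) (suc n) (λ i → s j i * X i 1) (λ i′ → s (n ∸ j) i′ * X i′ a))) (expand j)) ⟩
      ∑[ j < suc n ] ∑[ i < suc n ] ∑[ i′ < suc n ] (X i 1 * X i′ a * (+ (n C j) * (s j i * s (n ∸ j) i′)))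
        ≡⟨ ∑-comm (suc n) (suc n) (λ j i → ∑[ i′ < suc n ] (X i 1 * X i′ a * (+ (n C j) * (s j i * s (n ∸ j) i′)))) ⟩
      ∑[ i < suc n ] ∑[ j < suc n ] ∑[ i′ < suc n ] (X i 1 * X i′ a * (+ (n C j) * (s j i * s (n ∸ j) i′)))
        ≡⟨ ∑-cong (suc n) (λ i → ∑-comm (suc n) (suc n) (λ j i′ → X i 1 * X i′ a * (+ (n C j) * (s j i * s (n ∸ j) i′)))) ⟩
      ∑[ i < suc n ] ∑[ i′ < suc n ] ∑[ j < suc n ] (X i 1 * X i′ a * (+ (n C j) * (s j i * s (n ∸ j) i′)))
        ≡⟨ ∑-cong (suc n) (λ i → ∑-cong (suc n) (λ i′ → ∑-distribˡ (suc n) (X i 1 * X i′ a) (λ j → + (n C j) * (s j i * s (n ∸ j) i′)))) ⟩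
      ∑[ i < suc n ] ∑[ i′ < suc n ] (X i 1 * X i′ a * sConvolution n i i′) ∎
      where
      rearrange : ∀ c p x q y → c * (p * x * (q * y)) ≡ x * y * (c * (p * q))
      rearrange = solve-∀
      expand : ∀ j → + (n C j) * ∑[ i < suc n ] ∑[ i′ < suc n ] (s j i * X i 1 * (s (n ∸ j) i′ * X i′ a)) ≡
                     ∑[ i < suc n ] ∑[ i′ < suc n ] (X i 1 * X i′ a * (+ (n C j) * (s j i * s (n ∸ j) i′)))
      expand j = begin
        + (n C j) * ∑[ i < suc n ] ∑[ i′ < suc n ] (s j i * X i 1 * (s (n ∸ j) i′ * X i′ a))
          ≡⟨ ∑-distribˡ (suc n) (+ (n C j)) (λ i → ∑[ i′ < suc n ] (s j i * X i 1 * (s (n ∸ j) i′ * X i′ a))) ⟨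
        ∑[ i < suc n ] (+ (n C j) * ∑[ i′ < suc n ] (s j i * X i 1 * (s (n ∸ j) i′ * X i′ a)))
          ≡⟨ ∑-cong (suc n) (λ i → ∑-distribˡ (suc n) (+ (n C j)) (λ i′ → s j i * X i 1 * (s (n ∸ j) i′ * X i′ a))) ⟨
        ∑[ i < suc n ] ∑[ i′ < suc n ] (+ (n C j) * (s j i * X i 1 * (s (n ∸ j) i′ * X i′ a)))
          ≡⟨ ∑-cong (suc n) (λ i → ∑-cong (suc n) (λ i′ → rearrange (+ (n C j)) (s j i) (X i 1) (s (n ∸ j) i′) (X i′ a))) ⟩
        ∑[ i < suc n ] ∑[ i′ < suc n ] (X i 1 * X i′ a * (+ (n C j) * (s j i * s (n ∸ j) i′))) ∎

  s⊙-convolutive : ∀ X → Convolutive X → Convolutive (s ⊙ X)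
  s⊙-convolutive X convX n a = sym (begin
    ∑[ j < suc n ] (+ (n C j) * ((s ⊙ X) j 1 * (s ⊙ X) (n ∸ j) a))
      ≡⟨ s⊙-convolution X n a ⟩
    ∑[ i < suc n ] ∑[ i′ < suc n ] (X i 1 * X i′ a * sConvolution n i i′)
      ≡⟨ ∑-cong (suc n) (λ i → ∑-cong (suc n) (λ i′ → cong (X i 1 * X i′ a *_) (s-vandermonde n i i′))) ⟨
    ∑[ i < suc n ] ∑[ i′ < suc n ] F i i′
      ≡⟨ ∑-square-antidiagonal n F (λ i i′ n<i+i′ → trans (cong (λ z → X i 1 * X i′ a * (+ ((i ℕ.+ i′) C i) * z)) (a<c⇒s≡0 n<i+i′))
                                                           (times-zero (X i 1) (X i′ a) (+ ((i ℕ.+ i′) C i)))) ⟩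
    ∑[ c < suc n ] ∑[ i < suc c ] F i (c ∸ i)
      ≡⟨ ∑-cong (suc n) antidiagonal ⟩
    ∑[ c < suc n ] (s n c * (+ suc a * X c (suc a)))
      ≡⟨ ∑-cong (suc n) (λ c → swap (s n c) (+ suc a) (X c (suc a))) ⟩
    ∑[ c < suc n ] (+ suc a * (s n c * X c (suc a)))
      ≡⟨ ∑-distribˡ (suc n) (+ suc a) (λ c → s n c * X c (suc a)) ⟩
    + suc a * (s ⊙ X) n (suc a) ∎)
    where
    F : ℕ → ℕ → ℤ
    F i i′ = X i 1 * X i′ a * (+ ((i ℕ.+ i′) C i) * s n (i ℕ.+ i′))
    times-zero : ∀ x y c → x * y * (c * + 0) ≡ + 0
    times-zero = solve-∀
    swap : ∀ σ k x → σ * (k * x) ≡ k * (σ * x)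
    swap = solve-∀
    regroup : ∀ x y c σ → x * y * (c * σ) ≡ σ * (c * (x * y))
    regroup = solve-∀
    antidiagonal : ∀ c → ∑[ i < suc c ] F i (c ∸ i) ≡ s n c * (+ suc a * X c (suc a))
    antidiagonal c = begin
      ∑[ i < suc c ] F i (c ∸ i)
        ≡⟨ ∑-cong-< (suc c) (λ i i<1+c → cong (λ m → X i 1 * X (c ∸ i) a * (+ (m C i) * s n m)) (ℕ.m+[n∸m]≡n (ℕ.≤-pred i<1+c))) ⟩
      ∑[ i < suc c ] (X i 1 * X (c ∸ i) a * (+ (c C i) * s n c))
        ≡⟨ ∑-cong (suc c) (λ i → regroup (X i 1) (X (c ∸ i) a) (+ (c C i)) (s n c)) ⟩
      ∑[ i < suc c ] (s n c * (+ (c C i) * (X i 1 * X (c ∸ i) a)))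
        ≡⟨ ∑-distribˡ (suc c) (s n c) (λ i → + (c C i) * (X i 1 * X (c ∸ i) a)) ⟩
      s n c * ∑[ i < suc c ] (+ (c C i) * (X i 1 * X (c ∸ i) a))
        ≡⟨ cong (s n c *_) (convX c a) ⟨
      s n c * (+ suc a * X c (suc a)) ∎

  T-convolutive : ∀ k → Convolutive (T k)
  T-convolutive zero    = s-convolutive
  T-convolutive (suc k) n a = begin
    + suc a * T (suc k) n (suc a)
      ≡⟨ cong (+ suc a *_) (T-suc k n (suc a)) ⟩
    + suc a * (s ⊙ T k) n (suc a)
      ≡⟨ s⊙-convolutive (T k) (T-convolutive k) n a ⟩
    ∑[ j < suc n ] (+ (n C j) * ((s ⊙ T k) j 1 * (s ⊙ T k) (n ∸ j) a))
      ≡⟨ ∑-cong (suc n) (λ j → cong (+ (n C j) *_) (cong₂ _*_ (T-suc k j 1) (T-suc k (n ∸ j) a))) ⟨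
    ∑[ j < suc n ] (+ (n C j) * (T (suc k) j 1 * T (suc k) (n ∸ j) a)) ∎

module Partition where

  open import Data.Nat
  open import Data.Nat.Properties
  open import Data.List using (List; []; _∷_; map; concat; concatMap; upTo; _++_; _∷ʳ_; length)
  open import Data.List.Properties using (map-∘; map-cong; map-++; concatMap-++; upTo-∷ʳ; ++-identityʳ)
  open import Data.List.Relation.Unary.All as All using (All; []; _∷_)
  open import Data.List.Relation.Unary.All.Properties using (concat⁺; map⁺; applyUpTo⁺₁)
  open import Data.Product using (_×_; _,_)
  open import Function using (_∘_)
  open import Relation.Binary.PropositionalEquality
  open ≡-Reasoning

  partitions≤ : ℕ → ℕ → List (List ℕ)
  partitions≤ n m = partsAux n n m

  private
    concatMap-range-cong : ∀ {A : Set} {g h : ℕ → List A} k → (∀ q → g (suc q) ≡ h (suc q)) →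
                           concatMap g (range 1 k) ≡ concatMap h (range 1 k)
    concatMap-range-cong {g = g} {h} k eq = cong concat (begin
      map g (map suc (upTo k)) ≡⟨ map-∘ (upTo k) ⟨
      map (g ∘ suc) (upTo k)   ≡⟨ map-cong eq (upTo k) ⟩
      map (h ∘ suc) (upTo k)   ≡⟨ map-∘ (upTo k) ⟩
      map h (map suc (upTo k)) ∎)

  partsAux-fuel : ∀ {F F′} n m → n ≤ F → n ≤ F′ → partsAux F n m ≡ partsAux F′ n m
  partsAux-fuel zero    m _ _ = refl
  partsAux-fuel {suc F} {suc F′} (suc n) m (s≤s n≤F) (s≤s n≤F′) = concatMap-range-cong (m ⊓ suc n)
    (λ q → cong (map (suc q ∷_)) (partsAux-fuel (n ∸ q) (suc q) (≤-trans (m∸n≤m n q) n≤F) (≤-trans (m∸n≤m n q) n≤F′)))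

  partitions≤-⊓ : ∀ n {m m′} → m ⊓ n ≡ m′ ⊓ n → partitions≤ n m ≡ partitions≤ n m′
  partitions≤-⊓ zero    eq = refl
  partitions≤-⊓ (suc n) eq = cong (λ k → concatMap (λ p → map (p ∷_) (partsAux n (suc n ∸ p) p)) (range 1 k)) eq

  partitions≤-suc : ∀ {n m} → n ≤ m → partitions≤ n (suc m) ≡ partitions≤ n m
  partitions≤-suc {n} {m} n≤m = partitions≤-⊓ n (trans (m≥n⇒m⊓n≡n (m≤n⇒m≤1+n n≤m)) (sym (m≥n⇒m⊓n≡n n≤m)))

  partitions≤-self : ∀ {n m} → n ≤ m → partitions≤ n m ≡ partitions≤ n n
  partitions≤-self {n} {m} n≤m = partitions≤-⊓ n (trans (m≥n⇒m⊓n≡n n≤m) (sym (⊓-idem n)))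

  partitions≤-split : ∀ {m n} → m ≤ n →
    partitions≤ (suc n) (suc m) ≡ partitions≤ (suc n) m ++ map (suc m ∷_) (partitions≤ (n ∸ m) (suc m))
  partitions≤-split {m} {n} m≤n = begin
    concatMap g (range 1 (suc m ⊓ suc n))
      ≡⟨ cong (λ k → concatMap g (map suc (upTo (suc k)))) (m≤n⇒m⊓n≡m m≤n) ⟩
    concatMap g (map suc (upTo (suc m)))
      ≡⟨ cong (λ l → concatMap g (map suc l)) (upTo-∷ʳ m) ⟨
    concatMap g (map suc (upTo m ∷ʳ m))
      ≡⟨ cong (concatMap g) (map-++ suc (upTo m) (m ∷ [])) ⟩
    concatMap g (map suc (upTo m) ∷ʳ suc m)
      ≡⟨ concatMap-++ g (map suc (upTo m)) (suc m ∷ []) ⟩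
    concatMap g (map suc (upTo m)) ++ (g (suc m) ++ [])
      ≡⟨ cong₂ _++_ (cong (λ k → concatMap g (map suc (upTo k))) (m≤n⇒m⊓n≡m (m≤n⇒m≤1+n m≤n))) (sym (++-identityʳ (g (suc m)))) ⟨
    partitions≤ (suc n) m ++ g (suc m)
      ≡⟨ cong (λ l → partitions≤ (suc n) m ++ map (suc m ∷_) l) (partsAux-fuel (n ∸ m) (suc m) (m∸n≤m n m) ≤-refl) ⟩
    partitions≤ (suc n) m ++ map (suc m ∷_) (partitions≤ (n ∸ m) (suc m)) ∎
    where
    g : ℕ → List (List ℕ)
    g p = map (p ∷_) (partsAux n (suc n ∸ p) p)

  Bounded : ℕ → ℕ → List ℕ → Set
  Bounded m n = All (λ x → x ≤ m × x ≤ n)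

  partsAux-bounded : ∀ F n m → All (Bounded m n) (partsAux F n m)
  partsAux-bounded F       zero    m = [] ∷ []
  partsAux-bounded zero    (suc n) m = []
  partsAux-bounded (suc F) (suc n) m = concat⁺ (map⁺ (map⁺ (applyUpTo⁺₁ (λ x → x) (m ⊓ suc n) starting-at-suc)))
    where
    starting-at-suc : ∀ {q} → q < m ⊓ suc n → All (Bounded m (suc n)) (map (suc q ∷_) (partsAux F (n ∸ q) (suc q)))
    starting-at-suc {q} q<m⊓n = map⁺ (All.map (λ b → (1+q≤m , 1+q≤1+n) ∷ All.map weaken b) (partsAux-bounded F (n ∸ q) (suc q)))
      where
      1+q≤m : suc q ≤ m
      1+q≤m = ≤-trans q<m⊓n (m⊓n≤m m (suc n))
      1+q≤1+n : suc q ≤ suc n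
      1+q≤1+n = ≤-trans q<m⊓n (m⊓n≤n m (suc n))
      weaken : ∀ {x} → x ≤ suc q × x ≤ n ∸ q → x ≤ m × x ≤ suc n
      weaken (x≤1+q , x≤n∸q) = ≤-trans x≤1+q 1+q≤m , ≤-trans x≤n∸q (≤-trans (m∸n≤m n q) (n≤1+n n))

  partsAux-nonempty : ∀ F n m → All (λ λ′ → 0 < length λ′) (partsAux F (suc n) m)
  partsAux-nonempty zero    n m = []
  partsAux-nonempty (suc F) n m =
    concat⁺ (map⁺ (All.universal (λ p → map⁺ (All.universal (λ _ → s≤s z≤n) (partsAux F (suc n ∸ p) p))) (range 1 (m ⊓ suc n))))

module Multinomial where

  open import Data.Nat
  open import Data.Nat.Properties
  open import Data.Nat.Combinatorics using (_C_)
  open import Data.Nat.DivMod using (m*n/n≡m)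
  open import Data.Nat.Tactic.RingSolver using (solve-∀)
  open import Data.List using (List; _∷_; map; filter; length; _++_; replicate; applyUpTo)
  open import Data.List.Properties using (filter-++; length-++; filter-accept; filter-reject; filter-none)
  open import Data.List.Relation.Unary.All as All using (All; []; _∷_)
  open import Data.List.Relation.Unary.All.Properties using (++⁺; map⁺)
  open import Data.Empty using (⊥-elim)
  open import Relation.Nullary using (yes; no)
  open import Data.Product using (_,_)
  open import Function using (_∘_)
  open import Relation.Binary.PropositionalEquality
  open ≡-Reasoning
  open Binomial
  open Partition using (Bounded; partitions≤; partitions≤-suc; partitions≤-split; partsAux-bounded)

  ∏ : ℕ → (ℕ → ℕ) → ℕ
  ∏ zero    g = 1
  ∏ (suc N) g = g 0 * ∏ N (g ∘ suc)

  prodℕ-range : ∀ (g : ℕ → ℕ) N → prodℕ (map g (range 1 N)) ≡ ∏ N (g ∘ suc)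
  prodℕ-range g N = go g (λ i → i) N
    where
    go : ∀ (g : ℕ → ℕ) (h : ℕ → ℕ) N → prodℕ (map g (map suc (applyUpTo h N))) ≡ ∏ N (λ i → g (suc (h i)))
    go g h zero    = refl
    go g h (suc N) = cong (g (suc (h 0)) *_) (go g (h ∘ suc) N)

  ∏-cong-< : ∀ N {g h : ℕ → ℕ} → (∀ i → i < N → g i ≡ h i) → ∏ N g ≡ ∏ N h
  ∏-cong-< zero    eq = refl
  ∏-cong-< (suc N) eq = cong₂ _*_ (eq 0 (s≤s z≤n)) (∏-cong-< N (λ i i<N → eq (suc i) (s≤s i<N)))

  ∏-ones : ∀ N {g : ℕ → ℕ} → (∀ i → i < N → g i ≡ 1) → ∏ N g ≡ 1
  ∏-ones zero    eq = refl
  ∏-ones (suc N) eq = cong₂ _*_ (eq 0 (s≤s z≤n)) (∏-ones N (λ i i<N → eq (suc i) (s≤s i<N)))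

  ∏-split : ∀ m n (g : ℕ → ℕ) → ∏ (m + n) g ≡ ∏ m g * ∏ n (λ i → g (m + i))
  ∏-split zero    n g = sym (+-identityʳ _)
  ∏-split (suc m) n g = trans (cong (g 0 *_) (∏-split m n (g ∘ suc))) (sym (*-assoc (g 0) _ _))

  ∏-trailing-ones : ∀ n N (g : ℕ → ℕ) → n ≤ N → (∀ i → n ≤ i → g i ≡ 1) → ∏ N g ≡ ∏ n g
  ∏-trailing-ones n N g n≤N ones = begin
    ∏ N g                                ≡⟨ cong (λ k → ∏ k g) (m+[n∸m]≡n n≤N) ⟨
    ∏ (n + (N ∸ n)) g                    ≡⟨ ∏-split n (N ∸ n) g ⟩
    ∏ n g * ∏ (N ∸ n) (λ i → g (n + i))  ≡⟨ cong (∏ n g *_) (∏-ones (N ∸ n) (λ i _ → ones (n + i) (m≤m+n n i))) ⟩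
    ∏ n g * 1                            ≡⟨ *-identityʳ _ ⟩
    ∏ n g                                ∎

  ∏-single : ∀ N (g h : ℕ → ℕ) M X → M < N → g M ≡ X * h M → (∀ i → i ≢ M → g i ≡ h i) → ∏ N g ≡ X * ∏ N h
  ∏-single (suc N) g h zero    X _ gM others = begin
    g 0 * ∏ N (g ∘ suc)     ≡⟨ cong₂ _*_ gM (∏-cong-< N (λ i _ → others (suc i) (λ ()))) ⟩
    X * h 0 * ∏ N (h ∘ suc) ≡⟨ *-assoc X _ _ ⟩
    X * ∏ (suc N) h         ∎
  ∏-single (suc N) g h (suc M) X (s≤s M<N) gM others = begin
    g 0 * ∏ N (g ∘ suc)       ≡⟨ cong₂ _*_ (others 0 (λ ())) (∏-single N (g ∘ suc) (h ∘ suc) M X M<N gM (λ i i≢M → others (suc i) (i≢M ∘ suc-injective))) ⟩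
    h 0 * (X * ∏ N (h ∘ suc)) ≡⟨ x∙yz≡y∙xz (h 0) X _ ⟩
    X * ∏ (suc N) h           ∎
    where
    x∙yz≡y∙xz : ∀ x y z → x * (y * z) ≡ y * (x * z)
    x∙yz≡y∙xz = solve-∀

  mult-++ : ∀ j xs ys → mult j (xs ++ ys) ≡ mult j xs + mult j ys
  mult-++ j xs ys = trans (cong length (filter-++ (_≟ j) xs ys)) (length-++ (filter (_≟ j) xs))

  mult-replicate-self : ∀ c M → mult M (replicate c M) ≡ c
  mult-replicate-self zero    M = refl
  mult-replicate-self (suc c) M = trans (cong length (filter-accept (_≟ M) {x = M} {xs = replicate c M} refl)) (cong suc (mult-replicate-self c M))

  mult-replicate-other : ∀ c M j → j ≢ M → mult j (replicate c M) ≡ 0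
  mult-replicate-other zero    M j _   = refl
  mult-replicate-other (suc c) M j j≢M =
    trans (cong length (filter-reject (_≟ j) {x = M} {xs = replicate c M} (j≢M ∘ sym))) (mult-replicate-other c M j j≢M)

  mult-absent : ∀ j xs → All (_< j) xs → mult j xs ≡ 0
  mult-absent j xs all< = cong length (filter-none (_≟ j) (All.map <⇒≢ all<))

  denomFactor-absent : ∀ λ′ j → mult j λ′ ≡ 0 → denomFactor λ′ j ≡ 1
  denomFactor-absent λ′ j eq = cong (λ z → (j !) ^ z * (z !)) eq

  denom-replicate-++ : ∀ m c n μ → Bounded m n μ →
    denom (n + c * suc m) (replicate c (suc m) ++ μ) ≡ ((suc m !) ^ c * c !) * denom n μ
  denom-replicate-++ m zero    n μ _ = trans (cong (λ N → denom N μ) (+-identityʳ n)) (sym (*-identityˡ _))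
  denom-replicate-++ m (suc c) n μ bounded = begin
    denom N λ′                                  ≡⟨ prodℕ-range (denomFactor λ′) N ⟩
    ∏ N (denomFactor λ′ ∘ suc)                  ≡⟨ ∏-single N (denomFactor λ′ ∘ suc) (denomFactor μ ∘ suc) m X m<N at-M elsewhere ⟩
    X * ∏ N (denomFactor μ ∘ suc)               ≡⟨ cong (X *_) (∏-trailing-ones n N (denomFactor μ ∘ suc) (m≤m+n n _) beyond-n) ⟩
    X * ∏ n (denomFactor μ ∘ suc)               ≡⟨ cong (X *_) (prodℕ-range (denomFactor μ) n) ⟨
    X * denom n μ                               ∎
    where
    M = suc m
    N = n + suc c * M
    λ′ = replicate (suc c) M ++ μ
    X = (M !) ^ suc c * suc c !
    m<N : m < N
    m<N = ≤-trans (m≤m+n M (c * M)) (m≤n+m (suc c * M) n)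
    M∉μ : mult M μ ≡ 0
    M∉μ = mult-absent M μ (All.map (λ (x≤m , _) → s≤s x≤m) bounded)
    at-M : denomFactor λ′ M ≡ X * denomFactor μ M
    at-M = begin
      denomFactor λ′ M          ≡⟨ cong (λ z → (M !) ^ z * (z !)) (trans (mult-++ M (replicate (suc c) M) μ) (cong₂ _+_ (mult-replicate-self (suc c) M) M∉μ)) ⟩
      (M !) ^ (suc c + 0) * (suc c + 0) ! ≡⟨ cong (λ z → (M !) ^ z * z !) (+-identityʳ (suc c)) ⟩
      X                         ≡⟨ *-identityʳ X ⟨
      X * 1                     ≡⟨ cong (X *_) (denomFactor-absent μ M M∉μ) ⟨
      X * denomFactor μ M       ∎
    elsewhere : ∀ i → i ≢ m → denomFactor λ′ (suc i) ≡ denomFactor μ (suc i)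
    elsewhere i i≢m = cong (λ z → (suc i !) ^ z * z !)
      (trans (mult-++ (suc i) (replicate (suc c) M) μ) (cong (_+ mult (suc i) μ) (mult-replicate-other (suc c) M (suc i) (i≢m ∘ suc-injective))))
    beyond-n : ∀ i → n ≤ i → denomFactor μ (suc i) ≡ 1
    beyond-n i n≤i = denomFactor-absent μ (suc i) (mult-absent (suc i) μ (All.map (λ (_ , x≤n) → s≤s (≤-trans x≤n n≤i)) bounded))

  -- K m c = (c(m+1))! / ((m+1)!^c c!), the number of ways to split c(m+1) labelled
  -- points into c unlabelled blocks of size m + 1: choose the block of the smallest point first.
  K : ℕ → ℕ → ℕ
  K m zero    = 1
  K m (suc c) = ((m + c * suc m) C m) * K m c

  K*[[m+1]!^c*c!]≡[c[m+1]]! : ∀ m c → K m c * ((suc m !) ^ c * c !) ≡ (c * suc m) !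
  K*[[m+1]!^c*c!]≡[c[m+1]]! m zero    = refl
  K*[[m+1]!^c*c!]≡[c[m+1]]! m (suc c) = begin
    (x C m) * K m c * ((suc m !) ^ suc c * suc c !)
      ≡⟨ regroup (x C m) (K m c) m (m !) ((suc m !) ^ c) c (c !) ⟩
    (x C m) * (m ! * (K m c * ((suc m !) ^ c * c !))) * (suc m * suc c)
      ≡⟨ cong (λ z → (x C m) * (m ! * z) * (suc m * suc c)) (K*[[m+1]!^c*c!]≡[c[m+1]]! m c) ⟩
    (x C m) * (m ! * (c * suc m) !) * (suc m * suc c)
      ≡⟨ cong (λ z → (x C m) * (m ! * z !) * (suc m * suc c)) (m+n∸m≡n m (c * suc m)) ⟨
    (x C m) * (m ! * (x ∸ m) !) * (suc m * suc c)
      ≡⟨ cong (_* (suc m * suc c)) (nCk*k!*[n∸k]!≡n! (m≤m+n m _)) ⟩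
    x ! * (suc m * suc c)
      ≡⟨ reorder (x !) m c ⟩
    suc x * x ! ∎
    where
    x = m + c * suc m
    regroup : ∀ B Kc m mf P c cf → B * Kc * ((suc m * mf) * P * (suc c * cf)) ≡ B * (mf * (Kc * (P * cf))) * (suc m * suc c)
    regroup = solve-∀
    reorder : ∀ xf m c → xf * (suc m * suc c) ≡ suc (m + c * suc m) * xf
    reorder = solve-∀

  -- f is defined by truncated division; Exact n λ′ says that this division is exact.
  Exact : ℕ → List ℕ → Set
  Exact n λ′ = f n λ′ * denom n λ′ ≡ n !

  module _ (m c n : ℕ) (μ : List ℕ) (bounded : Bounded m n μ) (exact : Exact n μ) where
    private
      M = suc m
      N = n + c * M
      λ′ = replicate c M ++ μ
      Q = (N C (c * M)) * K m c * f n μ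
      N!≡Q*denom : N ! ≡ Q * denom N λ′
      N!≡Q*denom = begin
        N !                                                    ≡⟨ nCk*k!*[n∸k]!≡n! (m≤n+m (c * M) n) ⟨
        (N C (c * M)) * ((c * M) ! * (N ∸ c * M) !)            ≡⟨ cong (λ z → (N C (c * M)) * ((c * M) ! * z !)) (m+n∸n≡m n (c * M)) ⟩
        (N C (c * M)) * ((c * M) ! * n !)                      ≡⟨ cong₂ (λ y z → (N C (c * M)) * (y * z)) (K*[[m+1]!^c*c!]≡[c[m+1]]! m c) exact ⟨
        (N C (c * M)) * ((K m c * X) * (f n μ * denom n μ))    ≡⟨ regroup (N C (c * M)) (K m c) X (f n μ) (denom n μ) ⟩
        Q * (X * denom n μ)                                    ≡⟨ cong (Q *_) (denom-replicate-++ m c n μ bounded) ⟨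
        Q * denom N λ′                                         ∎
        where
        X = (M !) ^ c * c !
        regroup : ∀ B K X F D → B * ((K * X) * (F * D)) ≡ (B * K * F) * (X * D)
        regroup = solve-∀

    f-replicate-++ : f N λ′ ≡ (N C (c * M)) * K m c * f n μ
    f-replicate-++ = trans (cong (λ z → (z / denom N λ′) {{denom-nonZero N λ′}}) N!≡Q*denom) (m*n/n≡m Q (denom N λ′) {{denom-nonZero N λ′}})

    exact-replicate-++ : Exact N λ′
    exact-replicate-++ = trans (cong (_* denom N λ′) f-replicate-++) (sym N!≡Q*denom)

  replicate-++-∷ : ∀ c (M : ℕ) ν → replicate c M ++ (M ∷ ν) ≡ replicate (suc c) M ++ ν
  replicate-++-∷ zero    M ν = refl
  replicate-++-∷ (suc c) M ν = cong (M ∷_) (replicate-++-∷ c M ν)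

  [n∸m]+[c+1][m+1]≡[n+1]+c[m+1] : ∀ {n m} c → m ≤ n → (n ∸ m) + suc c * suc m ≡ suc n + c * suc m
  [n∸m]+[c+1][m+1]≡[n+1]+c[m+1] {n} {m} c m≤n = begin
    (n ∸ m) + (suc m + c * suc m)  ≡⟨ +-assoc (n ∸ m) (suc m) _ ⟨
    (n ∸ m) + suc m + c * suc m    ≡⟨ cong (_+ c * suc m) (+-suc (n ∸ m) m) ⟩
    suc (n ∸ m + m) + c * suc m    ≡⟨ cong (λ z → suc z + c * suc m) (m∸n+n≡m m≤n) ⟩
    suc n + c * suc m              ∎

  partitions≤-exact : ∀ m n → All (Exact n) (partitions≤ n m)
  prefixed-exact : ∀ m B n → n ≤ B → ∀ c →
    All (λ μ → Exact (n + c * suc m) (replicate c (suc m) ++ μ)) (partitions≤ n (suc m))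

  partitions≤-exact zero    zero    = refl ∷ []
  partitions≤-exact zero    (suc n) = []
  partitions≤-exact (suc m) n       = All.map (λ {μ} → subst (λ N → Exact N μ) (+-identityʳ n)) (prefixed-exact m n n ≤-refl 0)

  prefixed-exact m B n n≤B c with n ≤? m
  ... | yes n≤m = subst (All _) (sym (partitions≤-suc n≤m)) (all-exact-replicate-++ n)
    where
    all-exact-replicate-++ : ∀ n → All (λ μ → Exact (n + c * suc m) (replicate c (suc m) ++ μ)) (partitions≤ n m)
    all-exact-replicate-++ n = All.map (λ (b , e) → exact-replicate-++ m c n _ b e)
                                       (All.zip (partsAux-bounded n n m , partitions≤-exact m n))
  prefixed-exact m (suc B) (suc n) (s≤s n≤B) c | no n≰m =
    subst (All _) (sym (partitions≤-split m≤n))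
      (++⁺ (All.map (λ (b , e) → exact-replicate-++ m c (suc n) _ b e) (All.zip (partsAux-bounded (suc n) (suc n) m , partitions≤-exact m (suc n))))
           (map⁺ (All.map (λ {ν} → subst₂ Exact ([n∸m]+[c+1][m+1]≡[n+1]+c[m+1] c m≤n) (sym (replicate-++-∷ c (suc m) ν)))
                          (prefixed-exact m B (n ∸ m) (≤-trans (m∸n≤m n m) n≤B) (suc c)))))
    where
    m≤n : m ≤ n
    m≤n = ≤-pred (≰⇒> n≰m)
  prefixed-exact m B zero _ c | no n≰m = ⊥-elim (n≰m z≤n)

  [[c+1][m+1]]C[m+1]≡[c+1]*[m+c[m+1]]Cm : ∀ m c → (suc c * suc m) C suc m ≡ suc c * ((m + c * suc m) C m)
  [[c+1][m+1]]C[m+1]≡[c+1]*[m+c[m+1]]Cm m c = *-cancelʳ-≡ _ _ (suc m) (begin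
    (suc x C suc m) * suc m  ≡⟨ [n+1]C[k+1]*[k+1]≡[n+1]*nCk x m ⟩
    suc x * (x C m)          ≡⟨ reorder m c (x C m) ⟩
    suc c * (x C m) * suc m  ∎)
    where
    x = m + c * suc m
    reorder : ∀ m c b → suc (m + c * suc m) * b ≡ suc c * b * suc m
    reorder = solve-∀

  [c+1]*nC[[c+1][m+1]]*K[m,c+1]≡nC[m+1]*[n∸[m+1]]C[c[m+1]]*K[m,c] : ∀ m n c →
    suc c * ((n C (suc c * suc m)) * K m (suc c)) ≡ (n C suc m) * (((n ∸ suc m) C (c * suc m)) * K m c)
  [c+1]*nC[[c+1][m+1]]*K[m,c+1]≡nC[m+1]*[n∸[m+1]]C[c[m+1]]*K[m,c] m n c = begin
    suc c * ((n C (suc c * suc m)) * ((x C m) * K m c))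
      ≡⟨ regroup (suc c) (n C (suc c * suc m)) (x C m) (K m c) ⟩
    (n C (suc c * suc m)) * (suc c * (x C m)) * K m c
      ≡⟨ cong (λ z → (n C (suc c * suc m)) * z * K m c) ([[c+1][m+1]]C[m+1]≡[c+1]*[m+c[m+1]]Cm m c) ⟨
    (n C (suc m + c * suc m)) * ((suc m + c * suc m) C suc m) * K m c
      ≡⟨ cong (_* K m c) (nCa*[n∸a]Cb≡nC[a+b]*[a+b]Ca n (suc m) (c * suc m)) ⟨
    (n C suc m) * ((n ∸ suc m) C (c * suc m)) * K m c
      ≡⟨ *-assoc (n C suc m) _ _ ⟩
    (n C suc m) * (((n ∸ suc m) C (c * suc m)) * K m c) ∎
    where
    x = m + c * suc m
    regroup : ∀ a b c d → a * (b * (c * d)) ≡ b * (a * c) * d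
    regroup = solve-∀

module Bell (G : ℕ → ℤ) where

  open import Data.Nat as ℕ using (ℕ; zero; suc; _∸_; _<_; _≤_; z≤n; s≤s)
  open import Data.Integer using (ℤ; +_; _+_; _*_; _^_)

  import Data.Nat.Properties as ℕ
  open import Data.Nat.Combinatorics using (_C_; k>n⇒nCk≡0)
  open import Data.Integer.Properties
  open import Data.Integer.Tactic.RingSolver using (solve-∀)
  open import Data.Bool using (Bool; true; false; if_then_else_)
  open import Data.List using (List; []; _∷_; map; _++_; length; replicate; filter)
  open import Data.List.Properties using (map-∘)
  open import Data.List.Relation.Unary.All as All using (_∷_)
  open import Data.Product using (_,_)
  open import Data.Empty using (⊥-elim)
  open import Relation.Nullary using (yes; no; does)
  open import Relation.Binary.PropositionalEquality
  open ≡-Reasoning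
  open Sum
  open Binomial
  open Partition
  open Multinomial
  open IteratedStirling using (Convolutive)

  select : Bool → ℤ → ℤ
  select b z = if b then z else + 0

  select-*ˡ : ∀ b x y → select b (x * y) ≡ x * select b y
  select-*ˡ true  x y = refl
  select-*ˡ false x y = sym (*-zeroʳ x)

  weight : ℕ → ℕ → List ℕ → ℤ
  weight n a λ′ = select (does (length λ′ ℕ.≟ a)) (+ f n λ′ * prodℤ (map G λ′))

  -- B≤ m n a: the partial Bell polynomial B_(n,a)(G 1, G 2, …) restricted to partitions with parts ≤ m.
  B≤ : ℕ → ℕ → ℕ → ℤ
  B≤ m n a = sumℤ (map (weight n a) (partitions≤ n m))

  -- Parts equal to M = m + 1 are removed one copy at a time; c₀ counts the copies already removed.
  module Decomposition (m : ℕ) where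

    private
      M = suc m

    prefixedWeight : ℕ → ℕ → ℕ → List ℕ → ℤ
    prefixedWeight c₀ n a μ = select (does (length μ ℕ.≟ a)) (+ f (n ℕ.+ c₀ ℕ.* M) (replicate c₀ M ++ μ) * prodℤ (map G μ))

    prefixed : ℕ → ℕ → ℕ → ℤ
    prefixed c₀ n a = sumℤ (map (prefixedWeight c₀ n a) (partitions≤ n M))

    coefficient : ℕ → ℕ → ℕ → ℤ
    coefficient c₀ n c = + (((n ℕ.+ c₀ ℕ.* M) C ((c₀ ℕ.+ c) ℕ.* M)) ℕ.* K m (c₀ ℕ.+ c)) * G M ^ c

    prefixed-small-parts : ∀ c₀ n a → sumℤ (map (prefixedWeight c₀ n a) (partitions≤ n m)) ≡ coefficient c₀ n 0 * B≤ m n a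
    prefixed-small-parts c₀ n a = begin
      sumℤ (map (prefixedWeight c₀ n a) (partitions≤ n m))
        ≡⟨ sumℤ-map-cong (All.map (λ (b , e) → factor-out _ b e) (All.zip (partsAux-bounded n n m , partitions≤-exact m n))) ⟩
      sumℤ (map (λ μ → + k * weight n a μ) (partitions≤ n m))
        ≡⟨ sumℤ-map-distribˡ (+ k) (weight n a) (partitions≤ n m) ⟩
      + k * B≤ m n a
        ≡⟨ cong (_* B≤ m n a) (*-identityʳ (+ k)) ⟨
      + k * + 1 * B≤ m n a
        ≡⟨ cong (λ c → + (((n ℕ.+ c₀ ℕ.* M) C (c ℕ.* M)) ℕ.* K m c) * + 1 * B≤ m n a) (ℕ.+-identityʳ c₀) ⟨
      coefficient c₀ n 0 * B≤ m n a ∎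
      where
      k = ((n ℕ.+ c₀ ℕ.* M) C (c₀ ℕ.* M)) ℕ.* K m c₀
      factor-out : ∀ μ → Bounded m n μ → Exact n μ → prefixedWeight c₀ n a μ ≡ + k * weight n a μ
      factor-out μ bounded exact = begin
        select ℓ≟a (+ f (n ℕ.+ c₀ ℕ.* M) (replicate c₀ M ++ μ) * prodℤ (map G μ))
          ≡⟨ cong (λ z → select ℓ≟a (+ z * prodℤ (map G μ))) (f-replicate-++ m c₀ n μ bounded exact) ⟩
        select ℓ≟a (+ (k ℕ.* f n μ) * prodℤ (map G μ))
          ≡⟨ cong (select ℓ≟a) (trans (cong (_* prodℤ (map G μ)) (pos-* k (f n μ))) (*-assoc (+ k) (+ f n μ) (prodℤ (map G μ)))) ⟩
        select ℓ≟a (+ k * (+ f n μ * prodℤ (map G μ)))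
          ≡⟨ select-*ˡ ℓ≟a (+ k) (+ f n μ * prodℤ (map G μ)) ⟩
        + k * weight n a μ ∎
        where
        ℓ≟a = does (length μ ℕ.≟ a)

    coefficient-vanishes : ∀ c₀ n c → n ≤ m → coefficient c₀ n (suc c) ≡ + 0
    coefficient-vanishes c₀ n c n≤m = begin
      + ((N C ((c₀ ℕ.+ suc c) ℕ.* M)) ℕ.* K m (c₀ ℕ.+ suc c)) * G M ^ suc c
        ≡⟨ cong (λ z → + (z ℕ.* K m (c₀ ℕ.+ suc c)) * G M ^ suc c) (k>n⇒nCk≡0 N<[c₀+c+1]M) ⟩
      + 0 * G M ^ suc c
        ≡⟨ *-zeroˡ (G M ^ suc c) ⟩
      + 0 ∎
      where
      N = n ℕ.+ c₀ ℕ.* M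
      n<[c+1]M : n < suc c ℕ.* M
      n<[c+1]M = ℕ.≤-trans (s≤s n≤m) (ℕ.m≤m+n M (c ℕ.* M))
      N<[c₀+c+1]M : N < (c₀ ℕ.+ suc c) ℕ.* M
      N<[c₀+c+1]M = subst₂ _<_ (ℕ.+-comm (c₀ ℕ.* M) n) (sym (ℕ.*-distribʳ-+ M c₀ (suc c))) (ℕ.+-monoʳ-< (c₀ ℕ.* M) n<[c+1]M)

    prefixedWeight-peel : ∀ {n} c₀ a → m ≤ n → ∀ ν →
      prefixedWeight c₀ (suc n) (suc a) (M ∷ ν) ≡ G M * prefixedWeight (suc c₀) (n ∸ m) a ν
    prefixedWeight-peel {n} c₀ a m≤n ν = begin
      select ℓ≟a (+ f (suc n ℕ.+ c₀ ℕ.* M) (replicate c₀ M ++ M ∷ ν) * (G M * prodℤ (map G ν)))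
        ≡⟨ cong₂ (λ N λ′ → select ℓ≟a (+ f N λ′ * (G M * prodℤ (map G ν))))
                 ([n∸m]+[c+1][m+1]≡[n+1]+c[m+1] c₀ m≤n) (sym (replicate-++-∷ c₀ M ν)) ⟨
      select ℓ≟a (F * (G M * prodℤ (map G ν)))
        ≡⟨ cong (select ℓ≟a) (x∙yz≡y∙xz F (G M) (prodℤ (map G ν))) ⟩
      select ℓ≟a (G M * (F * prodℤ (map G ν)))
        ≡⟨ select-*ˡ ℓ≟a (G M) (F * prodℤ (map G ν)) ⟩
      G M * prefixedWeight (suc c₀) (n ∸ m) a ν ∎
      where
      ℓ≟a = does (length ν ℕ.≟ a)
      F = + f ((n ∸ m) ℕ.+ suc c₀ ℕ.* M) (replicate (suc c₀) M ++ ν)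
      x∙yz≡y∙xz : ∀ x y z → x * (y * z) ≡ y * (x * z)
      x∙yz≡y∙xz = solve-∀

    coefficient-peel : ∀ {n} c₀ c → m ≤ n → ∀ w →
      G M * (coefficient (suc c₀) (n ∸ m) c * w) ≡ coefficient c₀ (suc n) (suc c) * w
    coefficient-peel {n} c₀ c m≤n w = begin
      G M * (+ k * G M ^ c * w)
        ≡⟨ regroup (+ k) (G M) (G M ^ c) w ⟩
      + k * G M ^ suc c * w
        ≡⟨ cong₂ (λ N c′ → + ((N C (c′ ℕ.* M)) ℕ.* K m c′) * G M ^ suc c * w)
                 ([n∸m]+[c+1][m+1]≡[n+1]+c[m+1] c₀ m≤n) (sym (ℕ.+-suc c₀ c)) ⟩
      coefficient c₀ (suc n) (suc c) * w ∎
      where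
      k = (((n ∸ m) ℕ.+ suc c₀ ℕ.* M) C ((suc c₀ ℕ.+ c) ℕ.* M)) ℕ.* K m (suc c₀ ℕ.+ c)
      regroup : ∀ k g gᶜ w → g * (k * gᶜ * w) ≡ k * (g * gᶜ) * w
      regroup = solve-∀

    prefixed-decomposition : ∀ B n → n ≤ B → ∀ c₀ a →
      prefixed c₀ n a ≡ ∑[ c < suc a ] (coefficient c₀ n c * B≤ m (n ∸ c ℕ.* M) (a ∸ c))
    prefixed-decomposition B n n≤B c₀ a with n ℕ.≤? m
    ... | yes n≤m = begin
      sumℤ (map (prefixedWeight c₀ n a) (partitions≤ n M))
        ≡⟨ cong (λ l → sumℤ (map (prefixedWeight c₀ n a) l)) (partitions≤-suc n≤m) ⟩
      sumℤ (map (prefixedWeight c₀ n a) (partitions≤ n m))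
        ≡⟨ prefixed-small-parts c₀ n a ⟩
      coefficient c₀ n 0 * B≤ m n a
        ≡⟨ +-identityʳ _ ⟨
      coefficient c₀ n 0 * B≤ m n a + + 0
        ≡⟨ cong (_+_ (coefficient c₀ n 0 * B≤ m n a)) (∑-zero a (λ c _ → vanishing-term c)) ⟨
      ∑[ c < suc a ] (coefficient c₀ n c * B≤ m (n ∸ c ℕ.* M) (a ∸ c)) ∎
      where
      vanishing-term : ∀ c → coefficient c₀ n (suc c) * B≤ m (n ∸ suc c ℕ.* M) (a ∸ suc c) ≡ + 0
      vanishing-term c = trans (cong (_* B≤ m (n ∸ suc c ℕ.* M) (a ∸ suc c)) (coefficient-vanishes c₀ n c n≤m)) (*-zeroˡ (B≤ m (n ∸ suc c ℕ.* M) (a ∸ suc c)))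
    prefixed-decomposition B       zero    _          c₀ a | no n≰m = ⊥-elim (n≰m z≤n)
    prefixed-decomposition (suc B) (suc n) (s≤s n≤B) c₀ a | no n≰m = begin
      sumℤ (map (prefixedWeight c₀ (suc n) a) (partitions≤ (suc n) M))
        ≡⟨ cong (λ l → sumℤ (map (prefixedWeight c₀ (suc n) a) l)) (partitions≤-split m≤n) ⟩
      sumℤ (map (prefixedWeight c₀ (suc n) a) (partitions≤ (suc n) m ++ map (M ∷_) L))
        ≡⟨ sumℤ-map-++ (prefixedWeight c₀ (suc n) a) (partitions≤ (suc n) m) (map (M ∷_) L) ⟩
      sumℤ (map (prefixedWeight c₀ (suc n) a) (partitions≤ (suc n) m)) + sumℤ (map (prefixedWeight c₀ (suc n) a) (map (M ∷_) L))
        ≡⟨ cong₂ _+_ (prefixed-small-parts c₀ (suc n) a) (trans (cong sumℤ (sym (map-∘ L))) (starting-with-M a)) ⟩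
      ∑[ c < suc a ] (coefficient c₀ (suc n) c * B≤ m (suc n ∸ c ℕ.* M) (a ∸ c)) ∎
      where
      m≤n : m ≤ n
      m≤n = ℕ.≤-pred (ℕ.≰⇒> n≰m)
      L = partitions≤ (n ∸ m) M
      shift-c : ∀ a c → G M * (coefficient (suc c₀) (n ∸ m) c * B≤ m ((n ∸ m) ∸ c ℕ.* M) (a ∸ c)) ≡
                        coefficient c₀ (suc n) (suc c) * B≤ m (suc n ∸ suc c ℕ.* M) (suc a ∸ suc c)
      shift-c a c = trans (coefficient-peel c₀ c m≤n _)
                          (cong (λ r → coefficient c₀ (suc n) (suc c) * B≤ m r (a ∸ c)) (ℕ.∸-+-assoc n m (c ℕ.* M)))
      starting-with-M : ∀ a → sumℤ (map (λ ν → prefixedWeight c₀ (suc n) a (M ∷ ν)) L) ≡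
                              ∑[ c < a ] (coefficient c₀ (suc n) (suc c) * B≤ m (suc n ∸ suc c ℕ.* M) (a ∸ suc c))
      starting-with-M zero    = sumℤ-map-zero (All.universal (λ ν → refl) L)
      starting-with-M (suc a) = begin
        sumℤ (map (λ ν → prefixedWeight c₀ (suc n) (suc a) (M ∷ ν)) L)
          ≡⟨ sumℤ-map-cong (All.universal (prefixedWeight-peel c₀ a m≤n) L) ⟩
        sumℤ (map (λ ν → G M * prefixedWeight (suc c₀) (n ∸ m) a ν) L)
          ≡⟨ sumℤ-map-distribˡ (G M) (prefixedWeight (suc c₀) (n ∸ m) a) L ⟩
        G M * prefixed (suc c₀) (n ∸ m) a
          ≡⟨ cong (G M *_) (prefixed-decomposition B (n ∸ m) (ℕ.≤-trans (ℕ.m∸n≤m n m) n≤B) (suc c₀) a) ⟩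
        G M * ∑[ c < suc a ] (coefficient (suc c₀) (n ∸ m) c * B≤ m ((n ∸ m) ∸ c ℕ.* M) (a ∸ c))
          ≡⟨ ∑-distribˡ (suc a) (G M) (λ c → coefficient (suc c₀) (n ∸ m) c * B≤ m ((n ∸ m) ∸ c ℕ.* M) (a ∸ c)) ⟨
        ∑[ c < suc a ] (G M * (coefficient (suc c₀) (n ∸ m) c * B≤ m ((n ∸ m) ∸ c ℕ.* M) (a ∸ c)))
          ≡⟨ ∑-cong (suc a) (shift-c a) ⟩
        ∑[ c < suc a ] (coefficient c₀ (suc n) (suc c) * B≤ m (suc n ∸ suc c ℕ.* M) (suc a ∸ suc c)) ∎

  multiplicityFactor : ℕ → ℕ → ℕ → ℤ
  multiplicityFactor m n c = + ((n C (c ℕ.* suc m)) ℕ.* K m c) * G (suc m) ^ c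

  B≤-decomposition : ∀ m n a →
    B≤ (suc m) n a ≡ ∑[ c < suc a ] (multiplicityFactor m n c * B≤ m (n ∸ c ℕ.* suc m) (a ∸ c))
  B≤-decomposition m n a = begin
    B≤ (suc m) n a
      ≡⟨ sumℤ-map-cong (All.universal (λ μ → cong (λ N → select (does (length μ ℕ.≟ a)) (+ f N μ * prodℤ (map G μ))) (sym (ℕ.+-identityʳ n)))
                                      (partitions≤ n (suc m))) ⟩
    prefixed 0 n a
      ≡⟨ prefixed-decomposition n n ℕ.≤-refl 0 a ⟩
    ∑[ c < suc a ] (coefficient 0 n c * B≤ m (n ∸ c ℕ.* suc m) (a ∸ c))
      ≡⟨ ∑-cong (suc a) (λ c → cong (λ N → + ((N C (c ℕ.* suc m)) ℕ.* K m c) * G (suc m) ^ c * B≤ m (n ∸ c ℕ.* suc m) (a ∸ c)) (ℕ.+-identityʳ n)) ⟩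
    ∑[ c < suc a ] (multiplicityFactor m n c * B≤ m (n ∸ c ℕ.* suc m) (a ∸ c)) ∎
    where open Decomposition m

  B≤-zero-bound : ∀ n a → B≤ 0 n (suc a) ≡ + 0
  B≤-zero-bound zero    a = refl
  B≤-zero-bound (suc n) a = refl

  private
    lift-product : ∀ {p q r s} → p ℕ.* q ≡ r ℕ.* s → ∀ x → + p * (+ q * x) ≡ + r * (+ s * x)
    lift-product {p} {q} {r} {s} eq x = begin
      + p * (+ q * x)   ≡⟨ *-assoc (+ p) (+ q) x ⟨
      + p * + q * x     ≡⟨ cong (_* x) (trans (sym (pos-* p q)) (trans (cong +_ eq) (pos-* r s))) ⟩
      + r * + s * x     ≡⟨ *-assoc (+ r) (+ s) x ⟩
      + r * (+ s * x)   ∎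

  module _ (m : ℕ) where

    private
      M = suc m
      φ = multiplicityFactor m

    B≤-recurrence-largest : ∀ n a →
      ∑[ c < suc (suc a) ] (+ c * (φ n c * B≤ m (n ∸ c ℕ.* M) (suc a ∸ c))) ≡ + (n C M) * (G M * B≤ M (n ∸ M) a)
    B≤-recurrence-largest n a = begin
      ∑[ c < suc (suc a) ] (+ c * (φ n c * B≤ m (n ∸ c ℕ.* M) (suc a ∸ c)))
        ≡⟨ ∑-head (suc a) (λ c → + c * (φ n c * B≤ m (n ∸ c ℕ.* M) (suc a ∸ c))) (*-zeroˡ (φ n 0 * B≤ m n (suc a))) ⟩
      ∑[ c < suc a ] (+ suc c * (φ n (suc c) * B≤ m (n ∸ suc c ℕ.* M) (a ∸ c)))
        ≡⟨ ∑-cong (suc a) term ⟩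
      ∑[ c < suc a ] (+ (n C M) * (G M * (φ (n ∸ M) c * B≤ m (n ∸ M ∸ c ℕ.* M) (a ∸ c))))
        ≡⟨ ∑-distribˡ (suc a) (+ (n C M)) (λ c → G M * (φ (n ∸ M) c * B≤ m (n ∸ M ∸ c ℕ.* M) (a ∸ c))) ⟩
      + (n C M) * ∑[ c < suc a ] (G M * (φ (n ∸ M) c * B≤ m (n ∸ M ∸ c ℕ.* M) (a ∸ c)))
        ≡⟨ cong (+ (n C M) *_) (∑-distribˡ (suc a) (G M) (λ c → φ (n ∸ M) c * B≤ m (n ∸ M ∸ c ℕ.* M) (a ∸ c))) ⟩
      + (n C M) * (G M * ∑[ c < suc a ] (φ (n ∸ M) c * B≤ m (n ∸ M ∸ c ℕ.* M) (a ∸ c)))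
        ≡⟨ cong (λ z → + (n C M) * (G M * z)) (B≤-decomposition m (n ∸ M) a) ⟨
      + (n C M) * (G M * B≤ M (n ∸ M) a) ∎
      where
      regroup : ∀ k g gᶜ w → k * (g * gᶜ) * w ≡ k * (g * (gᶜ * w))
      regroup = solve-∀
      regroup′ : ∀ k g gᶜ w → k * (g * (gᶜ * w)) ≡ g * (k * gᶜ * w)
      regroup′ = solve-∀
      term : ∀ c → + suc c * (φ n (suc c) * B≤ m (n ∸ suc c ℕ.* M) (a ∸ c)) ≡
                   + (n C M) * (G M * (φ (n ∸ M) c * B≤ m (n ∸ M ∸ c ℕ.* M) (a ∸ c)))
      term c = begin
        + suc c * (+ X * (G M * G M ^ c) * B≤ m (n ∸ suc c ℕ.* M) (a ∸ c))
          ≡⟨ cong (λ r → + suc c * (+ X * (G M * G M ^ c) * B≤ m r (a ∸ c))) (ℕ.∸-+-assoc n M (c ℕ.* M)) ⟨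
        + suc c * (+ X * (G M * G M ^ c) * w)
          ≡⟨ cong (+ suc c *_) (regroup (+ X) (G M) (G M ^ c) w) ⟩
        + suc c * (+ X * (G M * (G M ^ c * w)))
          ≡⟨ lift-product {suc c} {X} {n C M} {Y} ([c+1]*nC[[c+1][m+1]]*K[m,c+1]≡nC[m+1]*[n∸[m+1]]C[c[m+1]]*K[m,c] m n c) (G M * (G M ^ c * w)) ⟩
        + (n C M) * (+ Y * (G M * (G M ^ c * w)))
          ≡⟨ cong (+ (n C M) *_) (regroup′ (+ Y) (G M) (G M ^ c) w) ⟩
        + (n C M) * (G M * (+ Y * G M ^ c * w)) ∎
        where
        X = (n C (suc c ℕ.* M)) ℕ.* K m (suc c)
        Y = ((n ∸ M) C (c ℕ.* M)) ℕ.* K m c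
        w = B≤ m (n ∸ M ∸ c ℕ.* M) (a ∸ c)

    multiplicityFactor-swap : ∀ n c j w →
      φ n c * (+ ((n ∸ c ℕ.* M) C j) * (G j * w)) ≡ + (n C j) * (G j * (φ (n ∸ j) c * w))
    multiplicityFactor-swap n c j w = begin
      + (b₁ ℕ.* K m c) * G M ^ c * (+ b₂ * (G j * w))
        ≡⟨ cong (λ z → z * G M ^ c * (+ b₂ * (G j * w))) (pos-* b₁ (K m c)) ⟩
      + b₁ * + K m c * G M ^ c * (+ b₂ * (G j * w))
        ≡⟨ regroup (+ b₁) (+ K m c) (G M ^ c) (+ b₂) (G j) w ⟩
      + b₁ * (+ b₂ * (G j * (+ K m c * G M ^ c * w)))
        ≡⟨ lift-product {b₁} {b₂} {n C j} {b₄} (nCa*[n∸a]Cb≡nCb*[n∸b]Ca n (c ℕ.* M) j) _ ⟩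
      + (n C j) * (+ b₄ * (G j * (+ K m c * G M ^ c * w)))
        ≡⟨ cong (+ (n C j) *_) (regroup′ (+ b₄) (G j) (+ K m c) (G M ^ c) w) ⟩
      + (n C j) * (G j * (+ b₄ * + K m c * G M ^ c * w))
        ≡⟨ cong (λ z → + (n C j) * (G j * (z * G M ^ c * w))) (pos-* b₄ (K m c)) ⟨
      + (n C j) * (G j * (φ (n ∸ j) c * w)) ∎
      where
      b₁ = n C (c ℕ.* M)
      b₂ = (n ∸ c ℕ.* M) C j
      b₄ = (n ∸ j) C (c ℕ.* M)
      regroup : ∀ x k gᶜ y g w → x * k * gᶜ * (y * (g * w)) ≡ x * (y * (g * (k * gᶜ * w)))
      regroup = solve-∀
      regroup′ : ∀ y g k gᶜ w → y * (g * (k * gᶜ * w)) ≡ g * (y * k * gᶜ * w)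
      regroup′ = solve-∀

    B≤-recurrence-smaller :
      (∀ n a → + suc a * B≤ m n (suc a) ≡ ∑[ i < m ] (+ (n C suc i) * (G (suc i) * B≤ m (n ∸ suc i) a))) →
      ∀ n a → ∑[ c < suc (suc a) ] (+ (suc a ∸ c) * (φ n c * B≤ m (n ∸ c ℕ.* M) (suc a ∸ c))) ≡
              ∑[ i < m ] (+ (n C suc i) * (G (suc i) * B≤ M (n ∸ suc i) a))
    B≤-recurrence-smaller recurrence n a = begin
      ∑[ c < suc (suc a) ] (+ (suc a ∸ c) * F c)
        ≡⟨ ∑-init-last (suc a) (λ c → + (suc a ∸ c) * F c) ⟩
      ∑[ c < suc a ] (+ (suc a ∸ c) * F c) + + (suc a ∸ suc a) * F (suc a)
        ≡⟨ cong (_+_ (∑[ c < suc a ] (+ (suc a ∸ c) * F c))) (trans (cong (λ k → + k * F (suc a)) (ℕ.n∸n≡0 a)) (*-zeroˡ (F (suc a)))) ⟩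
      ∑[ c < suc a ] (+ (suc a ∸ c) * F c) + + 0
        ≡⟨ +-identityʳ _ ⟩
      ∑[ c < suc a ] (+ (suc a ∸ c) * F c)
        ≡⟨ ∑-cong-< (suc a) (λ c c<1+a → unfold c (ℕ.≤-pred c<1+a)) ⟩
      ∑[ c < suc a ] ∑[ i < m ] (φ n c * R c i)
        ≡⟨ ∑-comm (suc a) m (λ c i → φ n c * R c i) ⟩
      ∑[ i < m ] ∑[ c < suc a ] (φ n c * R c i)
        ≡⟨ ∑-cong m (λ i → ∑-cong (suc a) (swap-binomials i)) ⟩
      ∑[ i < m ] ∑[ c < suc a ] (+ (n C suc i) * (G (suc i) * (φ (n ∸ suc i) c * B≤ m (n ∸ suc i ∸ c ℕ.* M) (a ∸ c))))
        ≡⟨ ∑-cong m (λ i → refold i) ⟩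
      ∑[ i < m ] (+ (n C suc i) * (G (suc i) * B≤ M (n ∸ suc i) a)) ∎
      where
      F : ℕ → ℤ
      F c = φ n c * B≤ m (n ∸ c ℕ.* M) (suc a ∸ c)
      R : ℕ → ℕ → ℤ
      R c i = + ((n ∸ c ℕ.* M) C suc i) * (G (suc i) * B≤ m (n ∸ c ℕ.* M ∸ suc i) (a ∸ c))
      unfold : ∀ c → c ≤ a → + (suc a ∸ c) * F c ≡ ∑[ i < m ] (φ n c * R c i)
      unfold c c≤a = begin
        + (suc a ∸ c) * (φ n c * B≤ m (n ∸ c ℕ.* M) (suc a ∸ c))
          ≡⟨ cong (λ k → + k * (φ n c * B≤ m (n ∸ c ℕ.* M) k)) (ℕ.+-∸-assoc 1 c≤a) ⟩
        + suc (a ∸ c) * (φ n c * B≤ m (n ∸ c ℕ.* M) (suc (a ∸ c)))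
          ≡⟨ x∙yz≡y∙xz (+ suc (a ∸ c)) (φ n c) _ ⟩
        φ n c * (+ suc (a ∸ c) * B≤ m (n ∸ c ℕ.* M) (suc (a ∸ c)))
          ≡⟨ cong (φ n c *_) (recurrence (n ∸ c ℕ.* M) (a ∸ c)) ⟩
        φ n c * ∑[ i < m ] R c i
          ≡⟨ ∑-distribˡ m (φ n c) (R c) ⟨
        ∑[ i < m ] (φ n c * R c i) ∎
        where
        x∙yz≡y∙xz : ∀ x y z → x * (y * z) ≡ y * (x * z)
        x∙yz≡y∙xz = solve-∀
      swap-binomials : ∀ i c → φ n c * R c i ≡ + (n C suc i) * (G (suc i) * (φ (n ∸ suc i) c * B≤ m (n ∸ suc i ∸ c ℕ.* M) (a ∸ c)))
      swap-binomials i c = trans (cong (λ r → φ n c * (+ ((n ∸ c ℕ.* M) C suc i) * (G (suc i) * B≤ m r (a ∸ c)))) ∸-comm)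
                                 (multiplicityFactor-swap n c (suc i) _)
        where
        ∸-comm : n ∸ c ℕ.* M ∸ suc i ≡ n ∸ suc i ∸ c ℕ.* M
        ∸-comm = trans (ℕ.∸-+-assoc n (c ℕ.* M) (suc i)) (trans (cong (n ∸_) (ℕ.+-comm (c ℕ.* M) (suc i))) (sym (ℕ.∸-+-assoc n (suc i) (c ℕ.* M))))
      refold : ∀ i → ∑[ c < suc a ] (+ (n C suc i) * (G (suc i) * (φ (n ∸ suc i) c * B≤ m (n ∸ suc i ∸ c ℕ.* M) (a ∸ c)))) ≡
                     + (n C suc i) * (G (suc i) * B≤ M (n ∸ suc i) a)
      refold i = begin
        ∑[ c < suc a ] (+ (n C suc i) * (G (suc i) * (φ (n ∸ suc i) c * B≤ m (n ∸ suc i ∸ c ℕ.* M) (a ∸ c))))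
          ≡⟨ ∑-distribˡ (suc a) (+ (n C suc i)) (λ c → G (suc i) * (φ (n ∸ suc i) c * B≤ m (n ∸ suc i ∸ c ℕ.* M) (a ∸ c))) ⟩
        + (n C suc i) * ∑[ c < suc a ] (G (suc i) * (φ (n ∸ suc i) c * B≤ m (n ∸ suc i ∸ c ℕ.* M) (a ∸ c)))
          ≡⟨ cong (+ (n C suc i) *_) (∑-distribˡ (suc a) (G (suc i)) (λ c → φ (n ∸ suc i) c * B≤ m (n ∸ suc i ∸ c ℕ.* M) (a ∸ c))) ⟩
        + (n C suc i) * (G (suc i) * ∑[ c < suc a ] (φ (n ∸ suc i) c * B≤ m (n ∸ suc i ∸ c ℕ.* M) (a ∸ c)))
          ≡⟨ cong (λ z → + (n C suc i) * (G (suc i) * z)) (B≤-decomposition m (n ∸ suc i) a) ⟨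
        + (n C suc i) * (G (suc i) * B≤ M (n ∸ suc i) a) ∎

  B≤-recurrence : ∀ m n a → + suc a * B≤ m n (suc a) ≡ ∑[ i < m ] (+ (n C suc i) * (G (suc i) * B≤ m (n ∸ suc i) a))
  B≤-recurrence zero    n a = trans (cong (+ suc a *_) (B≤-zero-bound n a)) (*-zeroʳ (+ suc a))
  B≤-recurrence (suc m) n a = begin
    + suc a * B≤ (suc m) n (suc a)
      ≡⟨ cong (+ suc a *_) (B≤-decomposition m n (suc a)) ⟩
    + suc a * ∑[ c < suc (suc a) ] F c
      ≡⟨ ∑-distribˡ (suc (suc a)) (+ suc a) F ⟨
    ∑[ c < suc (suc a) ] (+ suc a * F c)
      ≡⟨ ∑-cong-< (suc (suc a)) (λ c c<2+a → split c (ℕ.≤-pred c<2+a)) ⟩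
    ∑[ c < suc (suc a) ] (+ (suc a ∸ c) * F c + + c * F c)
      ≡⟨ ∑-distrib-+ (suc (suc a)) (λ c → + (suc a ∸ c) * F c) (λ c → + c * F c) ⟩
    ∑[ c < suc (suc a) ] (+ (suc a ∸ c) * F c) + ∑[ c < suc (suc a) ] (+ c * F c)
      ≡⟨ cong₂ _+_ (B≤-recurrence-smaller m (B≤-recurrence m) n a) (B≤-recurrence-largest m n a) ⟩
    ∑[ i < m ] T i + T m
      ≡⟨ ∑-init-last m T ⟨
    ∑[ i < suc m ] T i ∎
    where
    F T : ℕ → ℤ
    F c = multiplicityFactor m n c * B≤ m (n ∸ c ℕ.* suc m) (suc a ∸ c)
    T i = + (n C suc i) * (G (suc i) * B≤ (suc m) (n ∸ suc i) a)
    split : ∀ c → c ≤ suc a → + suc a * F c ≡ + (suc a ∸ c) * F c + + c * F c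
    split c c≤1+a = begin
      + suc a * F c                ≡⟨ cong (λ k → + k * F c) (ℕ.m∸n+n≡m c≤1+a) ⟨
      + (suc a ∸ c ℕ.+ c) * F c    ≡⟨ cong (_* F c) (pos-+ (suc a ∸ c) c) ⟩
      (+ (suc a ∸ c) + + c) * F c  ≡⟨ *-distribʳ-+ (F c) (+ (suc a ∸ c)) (+ c) ⟩
      + (suc a ∸ c) * F c + + c * F c ∎

  B≤-self : ∀ {m n} a → n ≤ m → B≤ m n a ≡ B≤ n n a
  B≤-self {m} {n} a n≤m = cong (λ l → sumℤ (map (weight n a) l)) (partitions≤-self n≤m)

  B≤-no-parts : ∀ n → B≤ (suc n) (suc n) 0 ≡ + 0
  B≤-no-parts n = sumℤ-map-zero (All.map (λ {λ′} → no-parts {λ′}) (partsAux-nonempty (suc n) n (suc n)))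
    where
    no-parts : ∀ {λ′} → 0 < length λ′ → weight (suc n) 0 λ′ ≡ + 0
    no-parts {_ ∷ _} _ = refl

  B≤-unique : ∀ (X : ℕ → ℕ → ℤ) → Convolutive X →
              (∀ j → X (suc j) 1 ≡ G (suc j)) → X 0 1 ≡ + 0 → X 0 0 ≡ + 1 → (∀ n → X (suc n) 0 ≡ + 0) →
              ∀ a n → B≤ n n a ≡ X n a
  B≤-unique X convX X-G X01 X00 X-suc-0 zero    zero    = sym X00
  B≤-unique X convX X-G X01 X00 X-suc-0 zero    (suc n) = trans (B≤-no-parts n) (sym (X-suc-0 n))
  B≤-unique X convX X-G X01 X00 X-suc-0 (suc a) n       = *-cancelˡ-≡ (+ suc a) _ _ (begin
    + suc a * B≤ n n (suc a)
      ≡⟨ B≤-recurrence n n a ⟩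
    ∑[ i < n ] (+ (n C suc i) * (G (suc i) * B≤ n (n ∸ suc i) a))
      ≡⟨ ∑-cong n (λ i → cong (λ z → + (n C suc i) * z) (cong₂ _*_ (sym (X-G i)) (trans (B≤-self a (ℕ.m∸n≤m n (suc i))) (B≤-unique X convX X-G X01 X00 X-suc-0 a (n ∸ suc i))))) ⟩
    ∑[ i < n ] (+ (n C suc i) * (X (suc i) 1 * X (n ∸ suc i) a))
      ≡⟨ ∑-head n (λ j → + (n C j) * (X j 1 * X (n ∸ j) a)) first-term-vanishes ⟨
    ∑[ j < suc n ] (+ (n C j) * (X j 1 * X (n ∸ j) a))
      ≡⟨ convX n a ⟨
    + suc a * X n (suc a) ∎)
    where
    first-term-vanishes : + 1 * (X 0 1 * X n a) ≡ + 0
    first-term-vanishes = trans (*-identityˡ _) (trans (cong (_* X n a) X01) (*-zeroˡ (X n a)))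

  sumℤ-filter-length : ∀ (w : List ℕ → ℤ) a xs →
    sumℤ (map w (filter (λ l → length l ℕ.≟ a) xs)) ≡ sumℤ (map (λ l → select (does (length l ℕ.≟ a)) (w l)) xs)
  sumℤ-filter-length w a []       = refl
  sumℤ-filter-length w a (x ∷ xs) with length x ℕ.≡ᵇ a
  ... | true  = cong (_+_ (w x)) (sumℤ-filter-length w a xs)
  ... | false = trans (sumℤ-filter-length w a xs) (sym (+-identityˡ _))

  partialBell≡B≤ : ∀ n a → sumℤ (map (λ λ′ → + f n λ′ * prodℤ (map G λ′)) (partitionsOfLength n a)) ≡ B≤ n n a
  partialBell≡B≤ n a = sumℤ-filter-length (λ λ′ → + f n λ′ * prodℤ (map G λ′)) a (partitions n)

open import Data.Nat as ℕ using (suc; _∸_; z≤n; s≤s)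
import Data.Nat.Properties as ℕ
open import Data.Integer using (+_; _*_; -_; _^_)
open import Data.Integer.Properties using (*-comm; *-zeroˡ)
open import Relation.Binary.PropositionalEquality using (refl; sym; trans; cong; cong₂; module ≡-Reasoning)
open ≡-Reasoning
open Sum
open Stirling
open IteratedStirling

inner≡T : ∀ k n a → inner n (suc (suc k)) a ≡ T k n a
inner≡T k n a = trans (partialBell≡B≤ n a) (B≤-unique (T k) (T-convolutive k) (λ _ → refl) (T-lowerTriangular k (s≤s z≤n)) (T-zero-zero k) (T-suc-zero k) a n)
  where open Bell (λ j → T k j 1)

signed-e≡s : ∀ r i → (- + 1) ^ (suc r ℕ.+ i ∸ suc r) * e (suc r ℕ.+ i ∸ suc r) (oneTo (r ℕ.+ i)) ≡ s (suc r ℕ.+ i) (suc r)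
signed-e≡s r i = trans (cong (λ d → (- + 1) ^ d * e d (oneTo (r ℕ.+ i))) (ℕ.m+n∸m≡n (suc r) i)) (sym (s[r+d,r]≡[-1]^d*e[d] (suc r) i))

mainTheorem8 : (n k r : ℕ) → 2 ≤ k → 1 ≤ r → r ≤ n → t n k r ≡ rhs n k r
mainTheorem8 n (suc (suc k)) (suc r) _ _ _ = sym (begin
  rhs n (suc (suc k)) (suc r)
    ≡⟨ sumℤ-range _ (suc r) n ⟩
  ∑[ i < suc n ∸ suc r ] ((- + 1) ^ (suc r ℕ.+ i ∸ suc r) * e (suc r ℕ.+ i ∸ suc r) (oneTo (r ℕ.+ i)) * inner n (suc (suc k)) (suc r ℕ.+ i))
    ≡⟨ ∑-cong (suc n ∸ suc r) (λ i → cong₂ _*_ (signed-e≡s r i) (inner≡T k n (suc r ℕ.+ i))) ⟩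
  ∑[ i < suc n ∸ suc r ] (s (suc r ℕ.+ i) (suc r) * T k n (suc r ℕ.+ i))
    ≡⟨ ∑-from (suc r) (suc n) (λ a → s a (suc r) * T k n a) (λ a a<r → trans (cong (_* T k n a) (a<c⇒s≡0 a<r)) (*-zeroˡ (T k n a))) ⟩
  ∑[ a < suc n ] (s a (suc r) * T k n a)
    ≡⟨ ∑-cong (suc n) (λ a → *-comm (s a (suc r)) (T k n a)) ⟩
  (T k ⊙ s) n (suc r)
    ≡⟨ T-comm k n (suc r) ⟩
  (s ⊙ T k) n (suc r)
    ≡⟨ T-suc k n (suc r) ⟨
  t n (suc (suc k)) (suc r) ∎)
mainTheorem8 n 1 r (s≤s ()) _ _
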